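{- Let $M$ be a simple binary matroid and $e\in E(M)$. If $\mathrm{si}(M/e)$ has an induced restriction isomorphic to $M^*(K_{3,3})$, then $M$ has an induced restriction isomorphic to one of $M(C_4)$, $M(K_4)$, or $M^*(K_{3,3})$.
   Context: An induced restriction of a matroid $N$ is $N|F$ for a flat $F$ of $N$. $M(C_4)\cong U_{3,4}$; $M^*(K_{3,3})$ is the dual of the cycle matroid of $K_{3,3}$. -}

module Defs where

open import Data.Bool using (Bool; true; false; _∧_; _∨_; _xor_; not; if_then_else_)
open import Data.Nat using (ℕ; zero; suc)
open import Data.Fin using (Fin; zero; suc; _≟_)
open import Data.Vec using (Vec; []; _∷_; replicate; zipWith)
open import Data.Product using (Σ; ∃; _×_; _,_)
open import Data.Sum using (_⊎_)
open import Relation.Nullary using (¬_)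
open import Relation.Nullary.Decidable using (⌊_⌋)
open import Relation.Binary.PropositionalEquality using (_≡_)

Sub : ℕ → Set
Sub m = Fin m → Bool

_⊆_ : ∀ {m} → Sub m → Sub m → Set
Z ⊆ X = ∀ i → Z i ≡ true → X i ≡ true

_∪_ : ∀ {m} → Sub m → Sub m → Sub m
(X ∪ Y) i = X i ∨ Y i

｛_｝ : ∀ {m} → Fin m → Sub m
｛ e ｝ i = ⌊ i ≟ e ⌋

Empty : ∀ {m} → Sub m → Set
Empty Z = ∀ i → Z i ≡ false

record Matroid (m : ℕ) : Set₁ where
  field
    E   : Sub m
    Ind : Sub m → Set
open Matroid public

InCl : ∀ {m} → Matroid m → Sub m → Fin m → Set
InCl N X i = X i ≡ true ⊎ Σ (Sub _) (λ I → I ⊆ X × Ind N I × ¬ Ind N (I ∪ ｛ i ｝))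

Flat : ∀ {m} → Matroid m → Sub m → Set
Flat N F = F ⊆ E N × (∀ i → E N i ≡ true → InCl N F i → F i ≡ true)

Restrict : ∀ {m} → Matroid m → Sub m → Matroid m
Restrict N S = record { E = S ; Ind = λ X → X ⊆ S × Ind N X }

-- contraction N/e for a non-loop e: X independent iff X ∪ {e} independent in N
Contract : ∀ {m} → Matroid m → Fin m → Matroid m
Contract N e = record
  { E   = λ i → E N i ∧ not ⌊ i ≟ e ⌋
  ; Ind = λ X → X ⊆ (λ i → E N i ∧ not ⌊ i ≟ e ⌋) × Ind N (X ∪ ｛ e ｝) }

Nonloop : ∀ {m} → Matroid m → Fin m → Set
Nonloop N i = E N i ≡ true × Ind N ｛ i ｝

Parallel : ∀ {m} → Matroid m → Fin m → Fin m → Set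
Parallel N i j = Nonloop N i × Nonloop N j × ¬ Ind N (｛ i ｝ ∪ ｛ j ｝)

Simple : ∀ {m} → Matroid m → Set
Simple N = (∀ i → E N i ≡ true → Nonloop N i)
         × (∀ i j → Parallel N i j → i ≡ j)

-- R is a set of representatives, one per parallel class of non-loops;
-- si(N) is (up to isomorphism) the restriction N|R
SiReps : ∀ {m} → Matroid m → Sub m → Set
SiReps N R = R ⊆ E N
           × (∀ i → R i ≡ true → Nonloop N i)
           × (∀ i j → R i ≡ true → R j ≡ true → Parallel N i j → i ≡ j)
           × (∀ i → Nonloop N i → R i ≡ true ⊎ Σ (Fin _) (λ j → R j ≡ true × Parallel N i j))

Iso : ∀ {m k} → Matroid m → Matroid k → Set
Iso {m} {k} N N' =
  Σ (Fin m → Fin k) λ f → Σ (Fin k → Fin m) λ g →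
    (∀ i → E N i ≡ true → E N' (f i) ≡ true)
  × (∀ j → E N' j ≡ true → E N (g j) ≡ true)
  × (∀ i → E N i ≡ true → g (f i) ≡ i)
  × (∀ j → E N' j ≡ true → f (g j) ≡ j)
  × (∀ Y → Y ⊆ E N' →
       (Ind N' Y → Ind N (λ i → E N i ∧ Y (f i)))
     × (Ind N (λ i → E N i ∧ Y (f i)) → Ind N' Y))

HasInducedRestr : ∀ {m k} → Matroid m → Matroid k → Set
HasInducedRestr N N' = Σ (Sub _) λ F → Flat N F × Iso (Restrict N F) N'

GF2^ : ℕ → Set
GF2^ r = Vec Bool r

0v : ∀ {r} → GF2^ r
0v = replicate _ false

_⊕_ : ∀ {r} → GF2^ r → GF2^ r → GF2^ r
_⊕_ = zipWith _xor_

sumOver : ∀ {m r} → (Fin m → GF2^ r) → Sub m → GF2^ r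
sumOver {zero}  v Z = 0v
sumOver {suc m} v Z =
  (if Z zero then v zero else 0v) ⊕ sumOver (λ i → v (suc i)) (λ i → Z (suc i))

LinIndep : ∀ {m r} → (Fin m → GF2^ r) → Sub m → Set
LinIndep v X = ∀ Z → Z ⊆ X → sumOver v Z ≡ 0v → Empty Z

VecMatroid : ∀ {m r} → (Fin m → GF2^ r) → Matroid m
VecMatroid v = record { E = λ _ → true ; Ind = LinIndep v }

private
  o l : Bool
  o = false
  l = true

-- M(C4) ≅ U_{3,4}: e1, e2, e3, e1+e2+e3 in GF(2)^3
MC4-vecs : Fin 4 → GF2^ 3
MC4-vecs zero                   = l ∷ o ∷ o ∷ []
MC4-vecs (suc zero)             = o ∷ l ∷ o ∷ []
MC4-vecs (suc (suc zero))       = o ∷ o ∷ l ∷ []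
MC4-vecs (suc (suc (suc zero))) = l ∷ l ∷ l ∷ []

-- M(K4): vertex-edge incidence of K4 with vertex 4 deleted (rows = vertices 1,2,3);
-- edges 14,24,34,12,13,23
MK4-vecs : Fin 6 → GF2^ 3
MK4-vecs zero                               = l ∷ o ∷ o ∷ []
MK4-vecs (suc zero)                         = o ∷ l ∷ o ∷ []
MK4-vecs (suc (suc zero))                   = o ∷ o ∷ l ∷ []
MK4-vecs (suc (suc (suc zero)))             = l ∷ l ∷ o ∷ []
MK4-vecs (suc (suc (suc (suc zero))))       = l ∷ o ∷ l ∷ []
MK4-vecs (suc (suc (suc (suc (suc zero))))) = o ∷ l ∷ l ∷ []

-- M*(K33): represented by a matrix whose rows span the cycle space of K33
-- (parts a1 a2 a3 / b1 b2 b3).  Rows = the 4-cycles C_ij = a1 b1 a_i b_j,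
-- (i,j) ∈ {(2,2),(2,3),(3,2),(3,3)}; column of an edge = cycles containing it.
-- Edge order: a1b1, a1b2, a1b3, a2b1, a3b1, a2b2, a2b3, a3b2, a3b3.
MK33*-vecs : Fin 9 → GF2^ 4
MK33*-vecs zero = l ∷ l ∷ l ∷ l ∷ []
MK33*-vecs (suc zero) = l ∷ o ∷ l ∷ o ∷ []
MK33*-vecs (suc (suc zero)) = o ∷ l ∷ o ∷ l ∷ []
MK33*-vecs (suc (suc (suc zero))) = l ∷ l ∷ o ∷ o ∷ []
MK33*-vecs (suc (suc (suc (suc zero)))) = o ∷ o ∷ l ∷ l ∷ []
MK33*-vecs (suc (suc (suc (suc (suc zero))))) = l ∷ o ∷ o ∷ o ∷ []
MK33*-vecs (suc (suc (suc (suc (suc (suc zero)))))) = o ∷ l ∷ o ∷ o ∷ []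
MK33*-vecs (suc (suc (suc (suc (suc (suc (suc zero))))))) = o ∷ o ∷ l ∷ o ∷ []
MK33*-vecs (suc (suc (suc (suc (suc (suc (suc (suc zero)))))))) = o ∷ o ∷ o ∷ l ∷ []

MC4 : Matroid 4
MC4 = VecMatroid MC4-vecs

MK4 : Matroid 6
MK4 = VecMatroid MK4-vecs

MK33* : Matroid 9
MK33* = VecMatroid MK33*-vecs

{-# OPTIONS --safe #-}
-- Let N = si(M/e) be realised as (M/e)|R, and let p map M*(K₃,₃) isomorphically onto N|F for a flat F of N.
-- In the representation of M*(K₃,₃) used here, columns 5, …, 8 are the unit vectors, so e, p₅, …, p₈ are
-- independent in M.  For k < 5 the set {k} ∪ supp(u_k) is a circuit of M*(K₃,₃), hence of M/e, which puts
-- p_k at coordinates (ε_k , u_k) with respect to e, p₅, …, p₈, for some ε_k ∈ GF(2).  As F is a flat of N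
-- and R meets every parallel class of M/e, the only other columns of M in this 5-dimensional space are e
-- itself, at (1 , 0), and "twins" (1 + ε_k , u_k) of some of the p_k.  So the restriction of M to this space
-- is determined by 14 bits, and for each of the 2¹⁴ possibilities an explicit subspace is checked to meet
-- the columns of M in a copy of M(C₄), M(K₄) or M*(K₃,₃).  The columns of M lying in a subspace always
-- form a flat of M, so this copy is an induced restriction.
module Submission where

open import Defs
open import Data.Bool using (Bool; true; false; _∧_; _∨_; _xor_; not; if_then_else_)
open import Data.Bool.ListAction using (all; any)
open import Data.Bool.Properties
  using ( xor-assoc; xor-comm; xor-same; xor-identityˡ; xor-identityʳ; ∧-zeroʳ; ∧-identityʳ
        ; ∨-identityʳ; ∨-zeroʳ; ∨-comm; ∧-conicalˡ; ∧-conicalʳ; not-injective; ¬-not )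
  renaming (_≟_ to _≟ᵇ_)
open import Data.Nat using (ℕ; zero; suc)
open import Data.Fin using (Fin; zero; suc; _≟_; _↑ˡ_; _↑ʳ_; splitAt; join)
open import Data.Fin.Properties using (any?; suc-injective; 0≢1+n; ↑ʳ-injective; splitAt-↑ˡ; splitAt-↑ʳ; join-splitAt)
open import Data.Vec using (Vec; []; _∷_; lookup; tabulate; replicate; head; tail)
open import Data.Vec.Properties
  using ( ≡-dec; lookup-zipWith; lookup∘tabulate; lookup-replicate; tabulate∘lookup; tabulate-cong
        ; zipWith-assoc; zipWith-comm; zipWith-identityˡ; zipWith-identityʳ )
open import Data.Vec.Functional using () renaming (_∷_ to _◂_)
open import Data.List using (List; []; _∷_)
open import Data.Maybe as Maybe using (Maybe; just; nothing; maybe′; is-just)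
open import Data.Maybe.Properties using (just-injective)
open import Data.Product using (Σ; ∃; _×_; _,_; proj₁; proj₂)
open import Data.Sum using (_⊎_; inj₁; inj₂; [_,_]′)
open import Data.Empty using (⊥; ⊥-elim)
open import Function using (_∘_)
open import Function.Definitions using (Injective)
open import Relation.Nullary using (¬_; Dec; yes; no)
open import Relation.Nullary.Decidable using (⌊_⌋)
open import Relation.Binary.PropositionalEquality

true≢false : true ≢ false
true≢false ()

｛｝-self : ∀ {m} (i : Fin m) → ｛ i ｝ i ≡ true
｛｝-self i with i ≟ i
... | yes _ = refl
... | no i≢i = ⊥-elim (i≢i refl)

｛｝-other : ∀ {m} {i j : Fin m} → i ≢ j → ｛ j ｝ i ≡ false
｛｝-other {i = i} {j} i≢j with i ≟ j
... | yes i≡j = ⊥-elim (i≢j i≡j)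
... | no _ = refl

｛｝-true : ∀ {m} {i j : Fin m} → ｛ j ｝ i ≡ true → i ≡ j
｛｝-true {i = i} {j} h with i ≟ j
... | yes i≡j = i≡j

｛suc｝-suc : ∀ {m} (k i : Fin m) → ｛ suc i ｝ (suc k) ≡ ｛ i ｝ k
｛suc｝-suc k i with k ≟ i
... | yes _ = refl
... | no _ = refl

⊕-assoc : ∀ {r} (x y z : GF2^ r) → (x ⊕ y) ⊕ z ≡ x ⊕ (y ⊕ z)
⊕-assoc = zipWith-assoc xor-assoc

⊕-comm : ∀ {r} (x y : GF2^ r) → x ⊕ y ≡ y ⊕ x
⊕-comm = zipWith-comm xor-comm

⊕-identityˡ : ∀ {r} (x : GF2^ r) → 0v ⊕ x ≡ x
⊕-identityˡ = zipWith-identityˡ xor-identityˡ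

⊕-identityʳ : ∀ {r} (x : GF2^ r) → x ⊕ 0v ≡ x
⊕-identityʳ = zipWith-identityʳ xor-identityʳ

⊕-self : ∀ {r} (x : GF2^ r) → x ⊕ x ≡ 0v
⊕-self [] = refl
⊕-self (a ∷ x) = cong₂ _∷_ (xor-same a) (⊕-self x)

≡⇒⊕≡0v : ∀ {r} {x y : GF2^ r} → x ≡ y → x ⊕ y ≡ 0v
≡⇒⊕≡0v {x = x} refl = ⊕-self x

⊕≡0v⇒≡ : ∀ {r} (x y : GF2^ r) → x ⊕ y ≡ 0v → x ≡ y
⊕≡0v⇒≡ x y h = begin
  x            ≡⟨ sym (⊕-identityʳ x) ⟩
  x ⊕ 0v       ≡⟨ cong (x ⊕_) (sym (⊕-self y)) ⟩
  x ⊕ (y ⊕ y)  ≡⟨ sym (⊕-assoc x y y) ⟩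
  (x ⊕ y) ⊕ y  ≡⟨ cong (_⊕ y) h ⟩
  0v ⊕ y       ≡⟨ ⊕-identityˡ y ⟩
  y            ∎
  where open ≡-Reasoning

⊕-interchange : ∀ {r} (p q s t : GF2^ r) → (p ⊕ q) ⊕ (s ⊕ t) ≡ (p ⊕ s) ⊕ (q ⊕ t)
⊕-interchange p q s t = begin
  (p ⊕ q) ⊕ (s ⊕ t)  ≡⟨ ⊕-assoc p q (s ⊕ t) ⟩
  p ⊕ (q ⊕ (s ⊕ t))  ≡⟨ cong (p ⊕_) (sym (⊕-assoc q s t)) ⟩
  p ⊕ ((q ⊕ s) ⊕ t)  ≡⟨ cong (λ w → p ⊕ (w ⊕ t)) (⊕-comm q s) ⟩
  p ⊕ ((s ⊕ q) ⊕ t)  ≡⟨ cong (p ⊕_) (⊕-assoc s q t) ⟩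
  p ⊕ (s ⊕ (q ⊕ t))  ≡⟨ sym (⊕-assoc p s (q ⊕ t)) ⟩
  (p ⊕ s) ⊕ (q ⊕ t)  ∎
  where open ≡-Reasoning

infix 4 _≟ᵛ_

_≟ᵛ_ : ∀ {r} (x y : GF2^ r) → Dec (x ≡ y)
_≟ᵛ_ = ≡-dec _≟ᵇ_

infixr 25 _·_

_·_ : ∀ {r} → Bool → GF2^ r → GF2^ r
b · x = if b then x else 0v

·-distrib-xor : ∀ {r} a b (x : GF2^ r) → (a xor b) · x ≡ a · x ⊕ b · x
·-distrib-xor true  true  x = sym (⊕-self x)
·-distrib-xor true  false x = sym (⊕-identityʳ x)
·-distrib-xor false true  x = sym (⊕-identityˡ x)
·-distrib-xor false false x = sym (⊕-identityˡ 0v)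

sumOver-congʳ : ∀ {m r} (v : Fin m → GF2^ r) {Z Z' : Sub m} → (∀ i → Z i ≡ Z' i) →
                sumOver v Z ≡ sumOver v Z'
sumOver-congʳ {zero}  v h = refl
sumOver-congʳ {suc m} v h = cong₂ (λ b s → b · v zero ⊕ s) (h zero) (sumOver-congʳ (v ∘ suc) (h ∘ suc))

sumOver-congˡ : ∀ {m r} {v v' : Fin m → GF2^ r} (Z : Sub m) → (∀ i → v i ≡ v' i) →
                sumOver v Z ≡ sumOver v' Z
sumOver-congˡ {zero}  Z h = refl
sumOver-congˡ {suc m} Z h = cong₂ (λ x s → Z zero · x ⊕ s) (h zero) (sumOver-congˡ (Z ∘ suc) (h ∘ suc))

sumOver-xor : ∀ {m r} (v : Fin m → GF2^ r) (X Y : Sub m) →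
              sumOver v (λ i → X i xor Y i) ≡ sumOver v X ⊕ sumOver v Y
sumOver-xor {zero}  v X Y = sym (⊕-identityˡ 0v)
sumOver-xor {suc m} v X Y =
  trans (cong₂ _⊕_ (·-distrib-xor (X zero) (Y zero) (v zero)) (sumOver-xor (v ∘ suc) (X ∘ suc) (Y ∘ suc)))
        (⊕-interchange _ _ _ _)

sumOver-empty : ∀ {m r} (v : Fin m → GF2^ r) (Z : Sub m) → Empty Z → sumOver v Z ≡ 0v
sumOver-empty {zero}  v Z h = refl
sumOver-empty {suc m} v Z h rewrite h zero =
  trans (⊕-identityˡ _) (sumOver-empty (v ∘ suc) (Z ∘ suc) (h ∘ suc))

sumOver-｛｝ : ∀ {m r} (v : Fin m → GF2^ r) (i : Fin m) → sumOver v ｛ i ｝ ≡ v i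
sumOver-｛｝ {suc m} v zero =
  trans (cong (v zero ⊕_) (sumOver-empty (v ∘ suc) _ (λ _ → refl))) (⊕-identityʳ _)
sumOver-｛｝ {suc m} v (suc i) =
  trans (⊕-identityˡ _) (trans (sumOver-congʳ (v ∘ suc) (λ k → ｛suc｝-suc k i)) (sumOver-｛｝ (v ∘ suc) i))

sumOver-·｛｝ : ∀ {m r} (v : Fin m → GF2^ r) (b : Bool) (i : Fin m) →
               sumOver v (λ k → b ∧ ｛ i ｝ k) ≡ b · v i
sumOver-·｛｝ v true  i = sumOver-｛｝ v i
sumOver-·｛｝ v false i = sumOver-empty v _ (λ _ → refl)

sumOver-unit : ∀ {n r} (w : Fin n → GF2^ r) (l : Fin n) → sumOver w (lookup (tabulate ｛ l ｝)) ≡ w l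
sumOver-unit w l = trans (sumOver-congʳ w (lookup∘tabulate ｛ l ｝)) (sumOver-｛｝ w l)

sumOver-⊆｛｝ : ∀ {m r} (v : Fin m → GF2^ r) (i : Fin m) (Z : Sub m) → Z ⊆ ｛ i ｝ → sumOver v Z ≡ Z i · v i
sumOver-⊆｛｝ v i Z Z⊆ = trans (sumOver-congʳ v Z≗) (sumOver-·｛｝ v (Z i) i)
  where
  Z≗ : ∀ k → Z k ≡ (Z i ∧ ｛ i ｝ k)
  Z≗ k with k ≟ i
  ... | yes refl = sym (∧-identityʳ (Z k))
  ... | no k≢i with Z k in Zk
  ...   | false = sym (∧-zeroʳ (Z i))
  ...   | true = ⊥-elim (true≢false (trans (sym (Z⊆ k Zk)) (｛｝-other k≢i)))

sumOver-⊆pair : ∀ {m r} (v : Fin m → GF2^ r) {i j : Fin m} → i ≢ j → (Z : Sub m) → Z ⊆ (｛ i ｝ ∪ ｛ j ｝) →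
                sumOver v Z ≡ Z i · v i ⊕ Z j · v j
sumOver-⊆pair v {i} {j} i≢j Z Z⊆ =
  trans (sumOver-congʳ v Z≗) (trans (sumOver-xor v _ _) (cong₂ _⊕_ (sumOver-·｛｝ v (Z i) i) (sumOver-·｛｝ v (Z j) j)))
  where
  Z≗ : ∀ k → Z k ≡ ((Z i ∧ ｛ i ｝ k) xor (Z j ∧ ｛ j ｝ k))
  Z≗ k with k ≟ i
  Z≗ k | yes refl rewrite ｛｝-other i≢j | ∧-zeroʳ (Z j) | ∧-identityʳ (Z k) = sym (xor-identityʳ (Z k))
  Z≗ k | no k≢i with k ≟ j
  Z≗ k | no k≢i | yes refl rewrite ∧-zeroʳ (Z i) | ∧-identityʳ (Z k) = refl
  Z≗ k | no k≢i | no k≢j rewrite ∧-zeroʳ (Z i) | ∧-zeroʳ (Z j) with Z k in Zk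
  ... | false = refl
  ... | true = ⊥-elim (true≢false (trans (sym (Z⊆ k Zk)) (cong₂ _∨_ (｛｝-other k≢i) (｛｝-other k≢j))))

record Linear {d r} (Ψ : GF2^ d → GF2^ r) : Set where
  field
    homo : ∀ x y → Ψ (x ⊕ y) ≡ Ψ x ⊕ Ψ y

  0↦0 : Ψ 0v ≡ 0v
  0↦0 = trans (cong Ψ (sym (⊕-self 0v))) (trans (homo 0v 0v) (⊕-self _))

  ·-homo : ∀ b x → Ψ (b · x) ≡ b · Ψ x
  ·-homo true  x = refl
  ·-homo false x = 0↦0

  injective : (∀ y → Ψ y ≡ 0v → y ≡ 0v) → ∀ x y → Ψ x ≡ Ψ y → x ≡ y
  injective ker x y Ψx≡Ψy = ⊕≡0v⇒≡ x y (ker _ (trans (homo x y) (≡⇒⊕≡0v Ψx≡Ψy)))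

open Linear using (homo; 0↦0; ·-homo)

∘-linear : ∀ {d e r} {Ψ : GF2^ e → GF2^ r} {Θ : GF2^ d → GF2^ e} → Linear Ψ → Linear Θ → Linear (Ψ ∘ Θ)
∘-linear {Ψ = Ψ} LΨ LΘ = record { homo = λ x y → trans (cong Ψ (homo LΘ x y)) (homo LΨ _ _) }

combination-linear : ∀ {d r} (b : Fin d → GF2^ r) → Linear (λ c → sumOver b (lookup c))
combination-linear b = record
  { homo = λ x y → trans (sumOver-congʳ b (λ l → lookup-zipWith _xor_ l x y)) (sumOver-xor b (lookup x) (lookup y)) }

sumOver-linear : ∀ {n d r} {Ψ : GF2^ d → GF2^ r} → Linear Ψ → (T : Fin n → GF2^ d) (Z : Sub n) →
                 Ψ (sumOver T Z) ≡ sumOver (Ψ ∘ T) Z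
sumOver-linear {zero}  L T Z = 0↦0 L
sumOver-linear {suc n} L T Z =
  trans (homo L _ _) (cong₂ _⊕_ (·-homo L (Z zero) (T zero)) (sumOver-linear L (T ∘ suc) (Z ∘ suc)))

sumOver-∈-image : ∀ {m d r} {Ψ : GF2^ d → GF2^ r} → Linear Ψ → (v : Fin m → GF2^ r) (Z : Sub m) →
                  (∀ i → Z i ≡ true → ∃ λ y → v i ≡ Ψ y) → ∃ λ y → sumOver v Z ≡ Ψ y
sumOver-∈-image {zero} L v Z h = 0v , sym (0↦0 L)
sumOver-∈-image {suc m} L v Z h with sumOver-∈-image L (v ∘ suc) (Z ∘ suc) (h ∘ suc) | Z zero in Z0
... | y , eq | false = y , trans (⊕-identityˡ _) eq
... | y , eq | true with h zero Z0
...   | y₀ , eq₀ = y₀ ⊕ y , trans (cong₂ _⊕_ eq₀ eq) (sym (homo L y₀ y))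

-- xor rather than ∨ makes sums split over the image; for injective q it is the image q[Y].
image : ∀ {n m} → (Fin n → Fin m) → Sub n → Sub m
image {zero}  q Y i = false
image {suc n} q Y i = (Y zero ∧ ｛ q zero ｝ i) xor image (q ∘ suc) (Y ∘ suc) i

sumOver-image : ∀ {n m r} (v : Fin m → GF2^ r) (q : Fin n → Fin m) (Y : Sub n) →
                sumOver v (image q Y) ≡ sumOver (v ∘ q) Y
sumOver-image {zero}  v q Y = sumOver-empty v _ (λ _ → refl)
sumOver-image {suc n} v q Y =
  trans (sumOver-xor v _ _) (cong₂ _⊕_ (sumOver-·｛｝ v (Y zero) (q zero)) (sumOver-image v (q ∘ suc) (Y ∘ suc)))

image-outside : ∀ {n m} (q : Fin n → Fin m) (Y : Sub n) (i : Fin m) → (∀ j → q j ≢ i) → image q Y i ≡ false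
image-outside {zero}  q Y i h = refl
image-outside {suc n} q Y i h rewrite ｛｝-other (h zero ∘ sym) | ∧-zeroʳ (Y zero) =
  image-outside (q ∘ suc) (Y ∘ suc) i (h ∘ suc)

image-at : ∀ {n m} (q : Fin n → Fin m) (Y : Sub n) → Injective _≡_ _≡_ q → ∀ j → image q Y (q j) ≡ Y j
image-at {suc n} q Y inj zero
  rewrite ｛｝-self (q zero) | ∧-identityʳ (Y zero)
        | image-outside (q ∘ suc) (Y ∘ suc) (q zero) (λ j qj≡q0 → 0≢1+n (sym (inj qj≡q0)))
  = xor-identityʳ (Y zero)
image-at {suc n} q Y inj (suc j)
  rewrite ｛｝-other {i = q (suc j)} {q zero} (λ qj≡q0 → 0≢1+n (sym (inj qj≡q0))) | ∧-zeroʳ (Y zero)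
  = image-at (q ∘ suc) (Y ∘ suc) (suc-injective ∘ inj) j

image-true : ∀ {n m} (q : Fin n → Fin m) (Y : Sub n) (i : Fin m) → image q Y i ≡ true →
             ∃ λ j → q j ≡ i × Y j ≡ true
image-true {suc n} q Y i h with Y zero ∧ ｛ q zero ｝ i in eq
... | true = zero , sym (｛｝-true (∧-conicalʳ _ _ eq)) , ∧-conicalˡ _ _ eq
... | false with image-true (q ∘ suc) (Y ∘ suc) i h
...   | j , qj≡i , Yj = suc j , qj≡i , Yj

image-preimage : ∀ {n m} (q : Fin n → Fin m) (Y : Sub n) (Z : Sub m) → Injective _≡_ _≡_ q →
                 Z ⊆ image q Y → ∀ i → Z i ≡ image q (Z ∘ q) i
image-preimage q Y Z inj Z⊆ i with Z i in Zi
... | true with image-true q Y i (Z⊆ i Zi)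
...   | j , refl , _ = sym (trans (image-at q (Z ∘ q) inj j) Zi)
image-preimage q Y Z inj Z⊆ i | false with any? (λ j → q j ≟ i)
...   | yes (j , refl) = sym (trans (image-at q (Z ∘ q) inj j) Zi)
...   | no ∄j = sym (image-outside q (Z ∘ q) i (λ j qj≡i → ∄j (j , qj≡i)))

image-suc : ∀ {n m} (q : Fin n → Fin m) (Y : Sub n) k → image (suc ∘ q) Y (suc k) ≡ image q Y k
image-suc {zero}  q Y k = refl
image-suc {suc n} q Y k =
  cong₂ (λ a b → (Y zero ∧ a) xor b) (｛suc｝-suc k (q zero)) (image-suc (q ∘ suc) (Y ∘ suc) k)

LinIndep-congʳ : ∀ {m r} (v : Fin m → GF2^ r) {X X' : Sub m} → (∀ i → X i ≡ X' i) →
                LinIndep v X → LinIndep v X'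
LinIndep-congʳ v X≗X' li Z Z⊆ = li Z (λ i Zi → trans (X≗X' i) (Z⊆ i Zi))

LinIndep-⊆ : ∀ {m r} (v : Fin m → GF2^ r) {X X' : Sub m} → X' ⊆ X → LinIndep v X → LinIndep v X'
LinIndep-⊆ v X'⊆X li Z Z⊆ = li Z (λ i Zi → X'⊆X i (Z⊆ i Zi))

LinIndep-congˡ : ∀ {m r} {v v' : Fin m → GF2^ r} (X : Sub m) → (∀ i → v i ≡ v' i) →
                 LinIndep v X → LinIndep v' X
LinIndep-congˡ X v≗v' li Z Z⊆ ΣZ≡0 = li Z Z⊆ (trans (sumOver-congˡ Z v≗v') ΣZ≡0)

LinIndep-image⁻ : ∀ {n m r} (v : Fin m → GF2^ r) (q : Fin n → Fin m) (Y : Sub n) → Injective _≡_ _≡_ q →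
                  LinIndep v (image q Y) → LinIndep (v ∘ q) Y
LinIndep-image⁻ v q Y inj li Z Z⊆Y ΣZ≡0 j with Z j in Zj
... | false = refl
... | true = ⊥-elim (true≢false (trans (sym (trans (image-at q Z inj j) Zj))
                                        (li (image q Z) qZ⊆qY (trans (sumOver-image v q Z) ΣZ≡0) (q j))))
  where
  qZ⊆qY : image q Z ⊆ image q Y
  qZ⊆qY i qZi with image-true q Z i qZi
  ... | k , refl , Zk = trans (image-at q Y inj k) (Z⊆Y k Zk)

LinIndep-image⁺ : ∀ {n m r} (v : Fin m → GF2^ r) (q : Fin n → Fin m) (Y : Sub n) → Injective _≡_ _≡_ q →
                  LinIndep (v ∘ q) Y → LinIndep v (image q Y)
LinIndep-image⁺ v q Y inj li Z Z⊆qY ΣZ≡0 i with Z i in Zi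
... | false = refl
... | true with image-true q Y i (Z⊆qY i Zi)
...   | j , refl , _ = ⊥-elim (true≢false (trans (sym Zi) (li (Z ∘ q) Zq⊆Y ΣZq≡0 j)))
  where
  Zq⊆Y : (Z ∘ q) ⊆ Y
  Zq⊆Y k Zqk = trans (sym (image-at q Y inj k)) (Z⊆qY (q k) Zqk)
  ΣZq≡0 : sumOver (v ∘ q) (Z ∘ q) ≡ 0v
  ΣZq≡0 = trans (sym (sumOver-image v q (Z ∘ q)))
                (trans (sumOver-congʳ v (λ k → sym (image-preimage q Y Z inj Z⊆qY k))) ΣZ≡0)

LinIndep-linear⁻ : ∀ {n d r} {Ψ : GF2^ d → GF2^ r} → Linear Ψ → (T : Fin n → GF2^ d) (Y : Sub n) →
                   LinIndep (Ψ ∘ T) Y → LinIndep T Y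
LinIndep-linear⁻ {Ψ = Ψ} L T Y li Z Z⊆Y ΣZ≡0 =
  li Z Z⊆Y (trans (sym (sumOver-linear L T Z)) (trans (cong Ψ ΣZ≡0) (0↦0 L)))

LinIndep-linear⁺ : ∀ {n d r} {Ψ : GF2^ d → GF2^ r} → Linear Ψ → (∀ y → Ψ y ≡ 0v → y ≡ 0v) →
                   (T : Fin n → GF2^ d) (Y : Sub n) → LinIndep T Y → LinIndep (Ψ ∘ T) Y
LinIndep-linear⁺ L ker T Y li Z Z⊆Y ΣZ≡0 = li Z Z⊆Y (ker _ (trans (sumOver-linear L T Z) ΣZ≡0))

LinIndep-∪-｛｝ : ∀ {m r} (v : Fin m → GF2^ r) (I : Sub m) (i : Fin m) → LinIndep v I →
                 (∀ Z → Z ⊆ I → v i ≢ sumOver v Z) → LinIndep v (I ∪ ｛ i ｝)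
LinIndep-∪-｛｝ v I i li i∉span Z Z⊆ ΣZ≡0 k with Z i in Zi
... | false = li Z Z⊆I ΣZ≡0 k
  where
  Z⊆I : Z ⊆ I
  Z⊆I j Zj with j ≟ i
  ... | yes refl = ⊥-elim (true≢false (trans (sym Zj) Zi))
  ... | no j≢i = trans (sym (∨-identityʳ (I j))) (trans (cong (I j ∨_) (sym (｛｝-other j≢i))) (Z⊆ j Zj))
... | true = ⊥-elim (i∉span Z' Z'⊆I (sym (⊕≡0v⇒≡ _ _ ΣZ'+vi≡0)))
  where
  Z' : Sub _
  Z' j = Z j ∧ not (｛ i ｝ j)
  Z≗Z'+i : ∀ j → Z j ≡ (Z' j xor ｛ i ｝ j)
  Z≗Z'+i j with j ≟ i
  ... | yes refl = trans Zi (cong (_xor true) (sym (∧-zeroʳ (Z j))))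
  ... | no _ rewrite ∧-identityʳ (Z j) = sym (xor-identityʳ (Z j))
  Z'⊆I : Z' ⊆ I
  Z'⊆I j Z'j with j ≟ i
  ... | yes refl = ⊥-elim (true≢false (trans (sym Z'j) (∧-zeroʳ (Z j))))
  ... | no j≢i = trans (sym (∨-identityʳ (I j)))
                       (trans (cong (I j ∨_) (sym (｛｝-other j≢i))) (Z⊆ j (∧-conicalˡ _ _ Z'j)))
  ΣZ'+vi≡0 : sumOver v Z' ⊕ v i ≡ 0v
  ΣZ'+vi≡0 = trans (cong (sumOver v Z' ⊕_) (sym (sumOver-｛｝ v i)))
              (trans (sym (sumOver-xor v Z' ｛ i ｝)) (trans (sumOver-congʳ v (sym ∘ Z≗Z'+i)) ΣZ≡0))

zero-sum⇒dependent : ∀ {m r} (v : Fin m → GF2^ r) (X : Sub m) i → sumOver v X ≡ 0v → X i ≡ true → ¬ LinIndep v X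
zero-sum⇒dependent v X i ΣX≡0 Xi li = true≢false (trans (sym Xi) (li X (λ _ z → z) ΣX≡0 i))

in-span⇒dependent : ∀ {m r} (v : Fin m → GF2^ r) (X Z : Sub m) i → Z ⊆ X → X i ≡ true → Z i ≡ false →
                    v i ≡ sumOver v Z → ¬ LinIndep v X
in-span⇒dependent v X Z i Z⊆X Xi Zi vi≡ΣZ = zero-sum⇒dependent v _ i ΣZ'≡0 Z'i ∘ LinIndep-⊆ v Z'⊆X
  where
  Z' : Sub _
  Z' j = ｛ i ｝ j xor Z j
  Z'i : Z' i ≡ true
  Z'i rewrite ｛｝-self i | Zi = refl
  Z'⊆X : Z' ⊆ X
  Z'⊆X j Z'j with j ≟ i
  ... | yes refl = Xi
  ... | no _ = Z⊆X j Z'j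
  ΣZ'≡0 : sumOver v Z' ≡ 0v
  ΣZ'≡0 = trans (sumOver-xor v ｛ i ｝ Z) (trans (cong (_⊕ sumOver v Z) (sumOver-｛｝ v i)) (≡⇒⊕≡0v vi≡ΣZ))

module _ {m r} {v : Fin m → GF2^ r} (simple : Simple (VecMatroid v)) where

  private
    independent-｛｝ : ∀ i → LinIndep v ｛ i ｝
    independent-｛｝ i = proj₂ (proj₁ simple i refl)

  simple⇒nonzero : ∀ i → v i ≢ 0v
  simple⇒nonzero i vi≡0 = true≢false (trans (sym (｛｝-self i))
    (independent-｛｝ i ｛ i ｝ (λ _ z → z) (trans (sumOver-｛｝ v i) vi≡0) i))

  simple⇒injective : Injective _≡_ _≡_ v
  simple⇒injective {i} {j} vi≡vj with i ≟ j
  ... | yes i≡j = i≡j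
  ... | no i≢j = proj₂ simple i j ((refl , independent-｛｝ i) , (refl , independent-｛｝ j) , dependent)
    where
    ∨≗xor : ∀ k → (｛ i ｝ k ∨ ｛ j ｝ k) ≡ (｛ i ｝ k xor ｛ j ｝ k)
    ∨≗xor k with k ≟ i
    ... | yes refl rewrite ｛｝-other i≢j = refl
    ... | no _ = refl
    dependent : ¬ LinIndep v (｛ i ｝ ∪ ｛ j ｝)
    dependent li = true≢false (trans (cong (_∨ ｛ j ｝ i) (sym (｛｝-self i)))
      (li (｛ i ｝ ∪ ｛ j ｝) (λ _ z → z)
          (trans (sumOver-congʳ v ∨≗xor) (trans (sumOver-xor v ｛ i ｝ ｛ j ｝)
            (trans (cong₂ _⊕_ (sumOver-｛｝ v i) (sumOver-｛｝ v j)) (≡⇒⊕≡0v vi≡vj)))) i))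

  simple⇒pair-independent : ∀ i j → i ≢ j → LinIndep v (｛ i ｝ ∪ ｛ j ｝)
  simple⇒pair-independent i j i≢j = LinIndep-∪-｛｝ v ｛ i ｝ j (independent-｛｝ i) j∉span
    where
    j∉span : ∀ Z → Z ⊆ ｛ i ｝ → v j ≢ sumOver v Z
    j∉span Z Z⊆ vj≡ΣZ with Z i | sumOver-⊆｛｝ v i Z Z⊆
    ... | true  | ΣZ≡ = i≢j (sym (simple⇒injective (trans vj≡ΣZ ΣZ≡)))
    ... | false | ΣZ≡ = simple⇒nonzero j (trans vj≡ΣZ ΣZ≡)

∈E/e⇒≢ : ∀ {m} {e j : Fin m} → not (｛ e ｝ j) ≡ true → j ≢ e
∈E/e⇒≢ {e = e} j∈E/e refl = true≢false (trans (sym j∈E/e) (cong not (｛｝-self e)))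

module _ {m r} {v : Fin m → GF2^ r} (simple : Simple (VecMatroid v)) {e : Fin m} where

  contraction-nonloop : ∀ {i} → i ≢ e → Nonloop (Contract (VecMatroid v) e) i
  contraction-nonloop {i} i≢e =
    ｛｝-other-not , (λ j j≡i → subst (λ k → not (｛ e ｝ k) ≡ true) (sym (｛｝-true j≡i)) ｛｝-other-not)
                   , simple⇒pair-independent simple i e i≢e
    where
    ｛｝-other-not : not (｛ e ｝ i) ≡ true
    ｛｝-other-not = cong not (｛｝-other i≢e)

  contraction-parallel : ∀ {i j} → i ≢ e → Parallel (Contract (VecMatroid v) e) i j → v j ≡ v i ⊎ v j ≡ v i ⊕ v e
  contraction-parallel {i} {j} i≢e (_ , (j∈E/e , _) , dependent) with v j ≟ᵛ v i | v j ≟ᵛ v i ⊕ v e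
  ... | yes vj≡vi | _ = inj₁ vj≡vi
  ... | no _ | yes vj≡vi+ve = inj₂ vj≡vi+ve
  ... | no vj≢vi | no vj≢vi+ve = ⊥-elim (dependent (ij⊆E/e , LinIndep-congʳ v reorder
          (LinIndep-∪-｛｝ v (｛ i ｝ ∪ ｛ e ｝) j (simple⇒pair-independent simple i e i≢e) j∉span)))
    where
    ij⊆E/e : (｛ i ｝ ∪ ｛ j ｝) ⊆ E (Contract (VecMatroid v) e)
    ij⊆E/e k k∈ with k ≟ i
    ... | yes refl = cong not (｛｝-other i≢e)
    ... | no _ = subst (λ k → not (｛ e ｝ k) ≡ true) (sym (｛｝-true k∈)) j∈E/e
    reorder : ∀ k → ((｛ i ｝ k ∨ ｛ e ｝ k) ∨ ｛ j ｝ k) ≡ ((｛ i ｝ k ∨ ｛ j ｝ k) ∨ ｛ e ｝ k)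
    reorder k with ｛ i ｝ k | ｛ j ｝ k | ｛ e ｝ k
    ... | true  | _     | _     = refl
    ... | false | true  | true  = refl
    ... | false | true  | false = refl
    ... | false | false | c     = ∨-identityʳ c
    j∉span : ∀ Z → Z ⊆ (｛ i ｝ ∪ ｛ e ｝) → v j ≢ sumOver v Z
    j∉span Z Z⊆ vj≡ΣZ with Z i | Z e | sumOver-⊆pair v i≢e Z Z⊆
    ... | true  | true  | ΣZ≡ = vj≢vi+ve (trans vj≡ΣZ ΣZ≡)
    ... | true  | false | ΣZ≡ = vj≢vi (trans vj≡ΣZ (trans ΣZ≡ (⊕-identityʳ _)))
    ... | false | true  | ΣZ≡ = ∈E/e⇒≢ j∈E/e (simple⇒injective simple (trans vj≡ΣZ (trans ΣZ≡ (⊕-identityˡ _))))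
    ... | false | false | ΣZ≡ = simple⇒nonzero simple j (trans vj≡ΣZ (trans ΣZ≡ (⊕-identityˡ _)))

module SubspaceRestriction
  {m r n d} (v : Fin m → GF2^ r) (v-injective : Injective _≡_ _≡_ v)
  (T : Fin n → GF2^ d) (T-injective : Injective _≡_ _≡_ T) (j₀ : Fin n)
  (Ψ : GF2^ d → GF2^ r) (Ψ-linear : Linear Ψ) (Ψ-kernel : ∀ y → Ψ y ≡ 0v → y ≡ 0v)
  (q : Fin n → Fin m) (q-realises : ∀ j → v (q j) ≡ Ψ (T j))
  (closed : ∀ i y → v i ≡ Ψ y → ∃ λ j → v i ≡ Ψ (T j)) where

  private
    inF? : (i : Fin m) → Dec (∃ λ j → v i ≡ Ψ (T j))
    inF? i = any? (λ j → v i ≟ᵛ Ψ (T j))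

    -- j₀ is a junk value: f only matters on F.
    witness : ∀ {i} → Dec (∃ λ j → v i ≡ Ψ (T j)) → Fin n
    witness (yes (j , _)) = j
    witness (no _) = j₀

  F : Sub m
  F i = ⌊ inF? i ⌋

  f : Fin m → Fin n
  f i = witness (inF? i)

  private
    F-true : ∀ i → F i ≡ true → v i ≡ Ψ (T (f i))
    F-true i h with inF? i
    ... | yes (j , vi≡) = vi≡

    F-intro : ∀ i j → v i ≡ Ψ (T j) → F i ≡ true
    F-intro i j vi≡ with inF? i
    ... | yes _ = refl
    ... | no ∄j = ⊥-elim (∄j (j , vi≡))

    Ψ-injective : ∀ x y → Ψ x ≡ Ψ y → x ≡ y
    Ψ-injective = Linear.injective Ψ-linear Ψ-kernel

    q-injective : Injective _≡_ _≡_ q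
    q-injective qj≡qj' = T-injective (Ψ-injective _ _ (trans (sym (q-realises _)) (trans (cong v qj≡qj') (q-realises _))))

    F-q : ∀ j → F (q j) ≡ true
    F-q j = F-intro (q j) j (q-realises j)

    q∘f : ∀ i → F i ≡ true → q (f i) ≡ i
    q∘f i Fi = v-injective (trans (q-realises (f i)) (sym (F-true i Fi)))

    f∘q : ∀ j → f (q j) ≡ j
    f∘q j = sym (T-injective (Ψ-injective _ _ (trans (sym (q-realises j)) (F-true (q j) (F-q j)))))

    pullback≗image : ∀ (Y : Sub n) i → (F i ∧ Y (f i)) ≡ image q Y i
    pullback≗image Y i with F i in Fi
    ... | true = trans (sym (image-at q Y q-injective (f i))) (cong (image q Y) (q∘f i Fi))
    ... | false = sym (image-outside q Y i (λ j qj≡i → true≢false (trans (sym (F-q j)) (trans (cong F qj≡i) Fi))))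

  flat : Flat (VecMatroid v) F
  flat = (λ i _ → refl) , closure
    where
    closure : ∀ i → true ≡ true → InCl (VecMatroid v) F i → F i ≡ true
    closure i _ (inj₁ Fi) = Fi
    closure i _ (inj₂ (I , I⊆F , liI , dep)) with F i in Fi
    ... | true = refl
    ... | false = ⊥-elim (dep (LinIndep-∪-｛｝ v I i liI i∉span))
      where
      i∉span : ∀ Z → Z ⊆ I → v i ≢ sumOver v Z
      i∉span Z Z⊆I vi≡ΣZ with sumOver-∈-image Ψ-linear v Z (λ k Zk → T (f k) , F-true k (I⊆F k (Z⊆I k Zk)))
      ... | y , ΣZ≡Ψy with closed i y (trans vi≡ΣZ ΣZ≡Ψy)
      ...   | j , vi≡ = true≢false (trans (sym (F-intro i j vi≡)) Fi)

  iso : Iso (Restrict (VecMatroid v) F) (VecMatroid T)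
  iso = f , q , (λ i _ → refl) , (λ j _ → F-q j) , q∘f , (λ j _ → f∘q j) , λ Y _ → to Y , from Y
    where
    to : ∀ Y → LinIndep T Y → ((λ i → F i ∧ Y (f i)) ⊆ F) × LinIndep v (λ i → F i ∧ Y (f i))
    to Y li = (λ i h → ∧-conicalˡ _ _ h)
            , LinIndep-congʳ v (sym ∘ pullback≗image Y)
                (LinIndep-image⁺ v q Y q-injective
                  (LinIndep-congˡ Y (sym ∘ q-realises) (LinIndep-linear⁺ Ψ-linear Ψ-kernel T Y li)))
    from : ∀ Y → ((λ i → F i ∧ Y (f i)) ⊆ F) × LinIndep v (λ i → F i ∧ Y (f i)) → LinIndep T Y
    from Y (_ , li) = LinIndep-linear⁻ Ψ-linear T Y
                        (LinIndep-congˡ Y q-realises (LinIndep-image⁻ v q Y q-injective (LinIndep-congʳ v (pullback≗image Y) li)))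

  induced-restriction : HasInducedRestr (VecMatroid v) (VecMatroid T)
  induced-restriction = F , flat , iso

allFinᵇ : ∀ n → (Fin n → Bool) → Bool
allFinᵇ zero    P = true
allFinᵇ (suc n) P = P zero ∧ allFinᵇ n (P ∘ suc)

allFinᵇ-sound : ∀ n (P : Fin n → Bool) → allFinᵇ n P ≡ true → ∀ j → P j ≡ true
allFinᵇ-sound (suc n) P h zero    = ∧-conicalˡ _ _ h
allFinᵇ-sound (suc n) P h (suc j) = allFinᵇ-sound n (P ∘ suc) (∧-conicalʳ (P zero) _ h) j

anyFinᵇ : ∀ n → (Fin n → Bool) → Bool
anyFinᵇ zero    P = false
anyFinᵇ (suc n) P = P zero ∨ anyFinᵇ n (P ∘ suc)

anyFinᵇ-sound : ∀ n (P : Fin n → Bool) → anyFinᵇ n P ≡ true → ∃ λ j → P j ≡ true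
anyFinᵇ-sound (suc n) P h with P zero in P0
... | true = zero , P0
... | false with anyFinᵇ-sound n (P ∘ suc) h
...   | j , Pj = suc j , Pj

allVecᵇ : ∀ d → (GF2^ d → Bool) → Bool
allVecᵇ zero    P = P []
allVecᵇ (suc d) P = allVecᵇ d (λ y → P (true ∷ y)) ∧ allVecᵇ d (λ y → P (false ∷ y))

allVecᵇ-sound : ∀ d (P : GF2^ d → Bool) → allVecᵇ d P ≡ true → ∀ y → P y ≡ true
allVecᵇ-sound zero    P h []          = h
allVecᵇ-sound (suc d) P h (true ∷ y)  = allVecᵇ-sound d _ (∧-conicalˡ _ _ h) y
allVecᵇ-sound (suc d) P h (false ∷ y) = allVecᵇ-sound d _ (∧-conicalʳ (allVecᵇ d (λ y → P (true ∷ y))) _ h) y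

_⊑_ : ∀ {d} → GF2^ d → GF2^ d → Set
y ⊑ x = ∀ l → lookup y l ≡ true → lookup x l ≡ true

allBelowᵇ : ∀ d → GF2^ d → (GF2^ d → Bool) → Bool
allBelowᵇ zero    []          P = P []
allBelowᵇ (suc d) (true ∷ x)  P = allBelowᵇ d x (λ y → P (true ∷ y)) ∧ allBelowᵇ d x (λ y → P (false ∷ y))
allBelowᵇ (suc d) (false ∷ x) P = allBelowᵇ d x (λ y → P (false ∷ y))

allBelowᵇ-sound : ∀ d x (P : GF2^ d → Bool) → allBelowᵇ d x P ≡ true → ∀ y → y ⊑ x → P y ≡ true
allBelowᵇ-sound zero    []          P h []          y⊑x = h
allBelowᵇ-sound (suc d) (true ∷ x)  P h (true ∷ y)  y⊑x = allBelowᵇ-sound d x _ (∧-conicalˡ _ _ h) y (y⊑x ∘ suc)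
allBelowᵇ-sound (suc d) (true ∷ x)  P h (false ∷ y) y⊑x =
  allBelowᵇ-sound d x _ (∧-conicalʳ (allBelowᵇ d x (λ y → P (true ∷ y))) _ h) y (y⊑x ∘ suc)
allBelowᵇ-sound (suc d) (false ∷ x) P h (true ∷ y)  y⊑x = ⊥-elim (true≢false (sym (y⊑x zero refl)))
allBelowᵇ-sound (suc d) (false ∷ x) P h (false ∷ y) y⊑x = allBelowᵇ-sound d x _ h y (y⊑x ∘ suc)

infix 10 _==ᵛ_

_==ᵛ_ : ∀ {d} → GF2^ d → GF2^ d → Bool
[]      ==ᵛ []      = true
(a ∷ x) ==ᵛ (b ∷ y) = ⌊ a ≟ᵇ b ⌋ ∧ (x ==ᵛ y)

==ᵛ-sound : ∀ {d} (x y : GF2^ d) → x ==ᵛ y ≡ true → x ≡ y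
==ᵛ-sound []      []      _ = refl
==ᵛ-sound (a ∷ x) (b ∷ y) h with a ≟ᵇ b
... | yes refl = cong (a ∷_) (==ᵛ-sound x y h)

==ᵛ-refl : ∀ {d} (x : GF2^ d) → x ==ᵛ x ≡ true
==ᵛ-refl []          = refl
==ᵛ-refl (true ∷ x)  = ==ᵛ-refl x
==ᵛ-refl (false ∷ x) = ==ᵛ-refl x

==ᵛ-≢ : ∀ {d} {x y : GF2^ d} → x ≢ y → x ==ᵛ y ≡ false
==ᵛ-≢ {x = x} {y} x≢y with x ==ᵛ y in x==y
... | true  = ⊥-elim (x≢y (==ᵛ-sound x y x==y))
... | false = refl

linIndepᵇ : ∀ {n d} → (Fin n → GF2^ d) → Sub n → Bool
linIndepᵇ {n} u Y = allBelowᵇ n (tabulate Y) (λ z → not (sumOver u (lookup z) ==ᵛ 0v) ∨ (z ==ᵛ 0v))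

linIndepᵇ-sound : ∀ {n d} (u : Fin n → GF2^ d) (Y : Sub n) → linIndepᵇ u Y ≡ true → LinIndep u Y
linIndepᵇ-sound {n} {d} u Y h Z Z⊆Y ΣZ≡0 k =
  trans (sym (lookup∘tabulate Z k)) (trans (cong (λ z → lookup z k) z≡0) (lookup-replicate k false))
  where
  z : Vec Bool n
  z = tabulate Z
  z⊑Y : z ⊑ tabulate Y
  z⊑Y l zl = trans (lookup∘tabulate Y l) (Z⊆Y l (trans (sym (lookup∘tabulate Z l)) zl))
  Σz≡0 : sumOver u (lookup z) ==ᵛ 0v ≡ true
  Σz≡0 = trans (cong (_==ᵛ 0v) (trans (sumOver-congʳ u (lookup∘tabulate Z)) ΣZ≡0)) (==ᵛ-refl {d} 0v)
  z≡0 : z ≡ 0v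
  z≡0 = ==ᵛ-sound z 0v (subst (λ b → (not b ∨ (z ==ᵛ 0v)) ≡ true) Σz≡0 (allBelowᵇ-sound n (tabulate Y) _ h z z⊑Y))

injectiveᵇ : ∀ {n d} → (Fin n → GF2^ d) → Bool
injectiveᵇ {n} T = allFinᵇ n λ j → allFinᵇ n λ j' → not (T j ==ᵛ T j') ∨ ⌊ j ≟ j' ⌋

injectiveᵇ-sound : ∀ {n d} (T : Fin n → GF2^ d) → injectiveᵇ T ≡ true → Injective _≡_ _≡_ T
injectiveᵇ-sound {n} T h {j} {j'} Tj≡Tj' = ｛｝-true (subst (λ b → (not b ∨ ⌊ j ≟ j' ⌋) ≡ true) Tj==Tj' check)
  where
  check : (not (T j ==ᵛ T j') ∨ ⌊ j ≟ j' ⌋) ≡ true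
  check = allFinᵇ-sound n _ (allFinᵇ-sound n _ h j) j'
  Tj==Tj' : T j ==ᵛ T j' ≡ true
  Tj==Tj' = trans (cong (T j ==ᵛ_) (sym Tj≡Tj')) (==ᵛ-refl (T j))

indexOf : ∀ {n d} → (Fin n → GF2^ d) → GF2^ d → Maybe (Fin n)
indexOf {zero}  T y = nothing
indexOf {suc n} T y = if T zero ==ᵛ y then just zero else Maybe.map suc (indexOf (T ∘ suc) y)

indexOf-sound : ∀ {n d} (T : Fin n → GF2^ d) y j → indexOf T y ≡ just j → T j ≡ y
indexOf-sound {suc n} T y j h with T zero ==ᵛ y in T0==y | indexOf (T ∘ suc) y in eq
indexOf-sound {suc n} T y zero h | true | _ = ==ᵛ-sound (T zero) y T0==y
indexOf-sound {suc n} T y (suc j) h | false | just j' rewrite suc-injective (just-injective h) =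
  indexOf-sound (T ∘ suc) y j eq

indexOf-complete : ∀ {n d} (T : Fin n → GF2^ d) → Injective _≡_ _≡_ T → ∀ j → indexOf T (T j) ≡ just j
indexOf-complete {suc n} T inj zero rewrite ==ᵛ-refl (T zero) = refl
indexOf-complete {suc n} T inj (suc j) with T zero ==ᵛ T (suc j) in T0==Tj
... | true = ⊥-elim (0≢1+n (inj (==ᵛ-sound (T zero) (T (suc j)) T0==Tj)))
... | false rewrite indexOf-complete (T ∘ suc) (suc-injective ∘ inj) j = refl

u : Fin 9 → GF2^ 4
u = MK33*-vecs

nonbasis : Fin 5 → Fin 9
nonbasis k = k ↑ˡ 4

basis : Fin 4 → Fin 9
basis l = 5 ↑ʳ l

basis-injective : Injective _≡_ _≡_ basis
basis-injective = ↑ʳ-injective 5 _ _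

basis≢nonbasis : ∀ l k → basis l ≢ nonbasis k
basis≢nonbasis l k h with trans (sym (splitAt-↑ʳ 5 4 l)) (trans (cong (splitAt 5) h) (splitAt-↑ˡ 5 k 4))
... | ()

nonbasis-or-basis : ∀ (P : Fin 9 → Set) → (∀ k → P (nonbasis k)) → (∀ l → P (basis l)) → ∀ k → P k
nonbasis-or-basis P P-nonbasis P-basis k = subst P (join-splitAt 5 4 k) (cases (splitAt 5 k))
  where
  cases : ∀ s → P (join 5 4 s)
  cases (inj₁ k) = P-nonbasis k
  cases (inj₂ l) = P-basis l

basis-unit : ∀ l → u (basis l) ≡ tabulate ｛ l ｝
basis-unit zero                   = refl
basis-unit (suc zero)             = refl
basis-unit (suc (suc zero))       = refl
basis-unit (suc (suc (suc zero))) = refl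

u-injective : Injective _≡_ _≡_ u
u-injective = injectiveᵇ-sound u refl

u-nonzero : ∀ k → u k ==ᵛ 0v ≡ false
u-nonzero k = not-injective (allFinᵇ-sound 9 (λ k → not (u k ==ᵛ 0v)) refl k)

onBasis : GF2^ 4 → Sub 9
onBasis x = image basis (lookup x)

basis-independent : LinIndep u (onBasis (replicate 4 true))
basis-independent = linIndepᵇ-sound u _ refl

fundamental-circuit : Fin 5 → Sub 9
fundamental-circuit k = ｛ nonbasis k ｝ ∪ onBasis (u (nonbasis k))

fundamental-circuit-dependent : ∀ k → ¬ LinIndep u (fundamental-circuit k)
fundamental-circuit-dependent k = zero-sum⇒dependent u (fundamental-circuit k) (nonbasis k)
  (==ᵛ-sound _ 0v (allFinᵇ-sound 5 (λ k → sumOver u (fundamental-circuit k) ==ᵛ 0v) refl k))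
  (cong (_∨ onBasis (u (nonbasis k)) (nonbasis k)) (｛｝-self (nonbasis k)))

fundamental-circuit-minimal : ∀ k x → x ⊑ u (nonbasis k) → x ≢ u (nonbasis k) →
                              LinIndep u (｛ nonbasis k ｝ ∪ onBasis x)
fundamental-circuit-minimal k x x⊑ x≢ = linIndepᵇ-sound u _
  (subst (λ b → (b ∨ linIndepᵇ u (｛ nonbasis k ｝ ∪ onBasis x)) ≡ true) (==ᵛ-≢ x≢) check)
  where
  check : ((x ==ᵛ u (nonbasis k)) ∨ linIndepᵇ u (｛ nonbasis k ｝ ∪ onBasis x)) ≡ true
  check = allBelowᵇ-sound 4 (u (nonbasis k)) _
            (allFinᵇ-sound 5 (λ k → allBelowᵇ 4 (u (nonbasis k))
                                      (λ x → (x ==ᵛ u (nonbasis k)) ∨ linIndepᵇ u (｛ nonbasis k ｝ ∪ onBasis x))) refl k)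
            x x⊑

εOf : Vec Bool 5 → Fin 9 → Bool
εOf εs k = [ lookup εs , (λ _ → false) ]′ (splitAt 5 k)

-- The points (t , x) of GF(2)⁵ carrying a column of M in the configuration given by ε₀, …, ε₄ and
-- twin₀, …, twin₈: e at (1 , 0), each p_k at (ε_k , u_k) (with ε₅ = … = ε₈ = 0), and the twins.
occupied : Vec Bool 5 → Vec Bool 9 → GF2^ 5 → Bool
occupied εs twins (t ∷ x) =
  if x ==ᵛ 0v then t else maybe′ (λ k → ⌊ t ≟ᵇ εOf εs k ⌋ ∨ lookup twins k) false (indexOf u x)

occupied-u : ∀ εs twins t k → occupied εs twins (t ∷ u k) ≡ (⌊ t ≟ᵇ εOf εs k ⌋ ∨ lookup twins k)
occupied-u εs twins t k rewrite u-nonzero k | indexOf-complete u u-injective k = refl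

data Target : Set where
  C₄ K₄ K₃₃* : Target

rank : Target → ℕ
rank C₄   = 3
rank K₄   = 3
rank K₃₃* = 4

size : Target → ℕ
size C₄   = 4
size K₄   = 6
size K₃₃* = 9

columns : (w : Target) → Fin (size w) → GF2^ (rank w)
columns C₄   = MC4-vecs
columns K₄   = MK4-vecs
columns K₃₃* = MK33*-vecs

columns-injective : ∀ w → Injective _≡_ _≡_ (columns w)
columns-injective C₄   = injectiveᵇ-sound MC4-vecs refl
columns-injective K₄   = injectiveᵇ-sound MK4-vecs refl
columns-injective K₃₃* = injectiveᵇ-sound MK33*-vecs refl

first-column : ∀ w → Fin (size w)
first-column C₄   = zero
first-column K₄   = zero
first-column K₃₃* = zero

isColumnᵇ : (w : Target) → GF2^ (rank w) → Bool
isColumnᵇ w y = anyFinᵇ (size w) (λ j → columns w j ==ᵛ y)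

-- A subspace of the coordinate space GF(2)⁵, given as the image of the matrix with columns
-- `embedding`.  The lists `inside` and `outside` are the images of the columns of the target and of
-- the remaining vectors; they are cached so that the exhaustive check does not recompute them for each
-- of the 2¹⁴ configurations.
record Template : Set where
  constructor template
  field
    target    : Target
    embedding : Vec (GF2^ 5) (rank target)
    inside    : List (GF2^ 5)
    outside   : List (GF2^ 5)
open Template

embed : (τ : Template) → GF2^ (rank (target τ)) → GF2^ 5
embed τ y = sumOver (lookup (embedding τ)) (lookup y)

_∈ᵇ_ : ∀ {d} → GF2^ d → List (GF2^ d) → Bool
x ∈ᵇ xs = any (x ==ᵛ_) xs

∈ᵇ-all : ∀ {d} (P : GF2^ d → Bool) x xs → x ∈ᵇ xs ≡ true → all P xs ≡ true → P x ≡ true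
∈ᵇ-all P x (z ∷ zs) x∈ Pzs with x ==ᵛ z in x==z
... | true  = subst (λ y → P y ≡ true) (sym (==ᵛ-sound x z x==z)) (∧-conicalˡ (P z) _ Pzs)
... | false = ∈ᵇ-all P x zs x∈ (∧-conicalʳ (P z) _ Pzs)

columns-insideᵇ others-outsideᵇ trivial-kernelᵇ valid : Template → Bool
columns-insideᵇ τ = allFinᵇ (size (target τ)) (λ j → embed τ (columns (target τ) j) ∈ᵇ inside τ)
others-outsideᵇ τ = allVecᵇ (rank (target τ)) (λ y → isColumnᵇ (target τ) y ∨ (embed τ y ∈ᵇ outside τ))
trivial-kernelᵇ τ = allVecᵇ (rank (target τ)) (λ y → not (embed τ y ==ᵛ 0v) ∨ (y ==ᵛ 0v))
valid τ = columns-insideᵇ τ ∧ others-outsideᵇ τ ∧ trivial-kernelᵇ τ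

module _ (τ : Template) (τ-valid : valid τ ≡ true) where

  columns-inside : ∀ j → embed τ (columns (target τ) j) ∈ᵇ inside τ ≡ true
  columns-inside = allFinᵇ-sound _ _ (∧-conicalˡ (columns-insideᵇ τ) _ τ-valid)

  others-outside : ∀ y → isColumnᵇ (target τ) y ≡ false → embed τ y ∈ᵇ outside τ ≡ true
  others-outside y not-column = subst (λ b → (b ∨ (embed τ y ∈ᵇ outside τ)) ≡ true) not-column
    (allVecᵇ-sound _ _ (∧-conicalˡ (others-outsideᵇ τ) _ (∧-conicalʳ (columns-insideᵇ τ) _ τ-valid)) y)

  embed-kernel : ∀ y → embed τ y ≡ 0v → y ≡ 0v
  embed-kernel y embed≡0 = ==ᵛ-sound y 0v (subst (λ b → (not b ∨ (y ==ᵛ 0v)) ≡ true)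
    (trans (cong (_==ᵛ 0v) embed≡0) (==ᵛ-refl {5} 0v))
    (allVecᵇ-sound _ _ (∧-conicalʳ (others-outsideᵇ τ) _ (∧-conicalʳ (columns-insideᵇ τ) _ τ-valid)) y))

fits : Vec Bool 5 → Vec Bool 9 → Template → Bool
fits εs twins τ = all (occupied εs twins) (inside τ) ∧ all (not ∘ occupied εs twins) (outside τ)

findTemplate : Vec Bool 5 → Vec Bool 9 → List Template → Maybe Template
findTemplate εs twins []       = nothing
findTemplate εs twins (τ ∷ τs) = if fits εs twins τ then just τ else findTemplate εs twins τs

findTemplate-sound : ∀ εs twins τs τ → all valid τs ≡ true → findTemplate εs twins τs ≡ just τ →
                     valid τ ≡ true × fits εs twins τ ≡ true
findTemplate-sound εs twins (τ' ∷ τs) τ valid-τs found with fits εs twins τ' in fit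
... | true  = subst (λ τ → valid τ ≡ true × fits εs twins τ ≡ true) (just-injective found)
                    (∧-conicalˡ _ _ valid-τs , fit)
... | false = findTemplate-sound εs twins τs τ (∧-conicalʳ (valid τ') _ valid-τs) found

module _ where
  private
    o l : Bool
    o = false
    l = true

  templates : List Template
  templates =
      template C₄
        ((o ∷ o ∷ o ∷ o ∷ l ∷ []) ∷ (o ∷ l ∷ o ∷ o ∷ o ∷ []) ∷ (l ∷ o ∷ o ∷ l ∷ l ∷ []) ∷ [])
        ((o ∷ o ∷ o ∷ o ∷ l ∷ []) ∷ (o ∷ l ∷ o ∷ o ∷ o ∷ []) ∷ (l ∷ o ∷ o ∷ l ∷ l ∷ []) ∷ (l ∷ l ∷ o ∷ l ∷ o ∷ []) ∷ [])
        ((o ∷ o ∷ o ∷ o ∷ o ∷ []) ∷ (l ∷ l ∷ o ∷ l ∷ l ∷ []) ∷ (l ∷ o ∷ o ∷ l ∷ o ∷ []) ∷ (o ∷ l ∷ o ∷ o ∷ l ∷ []) ∷ [])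
    ∷ template C₄
        ((o ∷ o ∷ o ∷ o ∷ l ∷ []) ∷ (o ∷ l ∷ o ∷ o ∷ o ∷ []) ∷ (l ∷ o ∷ l ∷ o ∷ l ∷ []) ∷ [])
        ((o ∷ o ∷ o ∷ o ∷ l ∷ []) ∷ (o ∷ l ∷ o ∷ o ∷ o ∷ []) ∷ (l ∷ o ∷ l ∷ o ∷ l ∷ []) ∷ (l ∷ l ∷ l ∷ o ∷ o ∷ []) ∷ [])
        ((o ∷ o ∷ o ∷ o ∷ o ∷ []) ∷ (l ∷ l ∷ l ∷ o ∷ l ∷ []) ∷ (l ∷ o ∷ l ∷ o ∷ o ∷ []) ∷ (o ∷ l ∷ o ∷ o ∷ l ∷ []) ∷ [])
    ∷ template K₃₃*
        ((o ∷ o ∷ o ∷ o ∷ l ∷ []) ∷ (o ∷ o ∷ o ∷ l ∷ o ∷ []) ∷ (o ∷ o ∷ l ∷ o ∷ o ∷ []) ∷ (o ∷ l ∷ o ∷ o ∷ o ∷ []) ∷ [])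
        ((o ∷ l ∷ l ∷ l ∷ l ∷ []) ∷ (o ∷ o ∷ l ∷ o ∷ l ∷ []) ∷ (o ∷ l ∷ o ∷ l ∷ o ∷ []) ∷ (o ∷ o ∷ o ∷ l ∷ l ∷ []) ∷
         (o ∷ l ∷ l ∷ o ∷ o ∷ []) ∷ (o ∷ o ∷ o ∷ o ∷ l ∷ []) ∷ (o ∷ o ∷ o ∷ l ∷ o ∷ []) ∷ (o ∷ o ∷ l ∷ o ∷ o ∷ []) ∷
         (o ∷ l ∷ o ∷ o ∷ o ∷ []) ∷ [])
        ((o ∷ o ∷ o ∷ o ∷ o ∷ []) ∷ (o ∷ o ∷ l ∷ l ∷ o ∷ []) ∷ (o ∷ l ∷ l ∷ l ∷ o ∷ []) ∷ (o ∷ l ∷ o ∷ o ∷ l ∷ []) ∷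
         (o ∷ l ∷ l ∷ o ∷ l ∷ []) ∷ (o ∷ l ∷ o ∷ l ∷ l ∷ []) ∷ (o ∷ o ∷ l ∷ l ∷ l ∷ []) ∷ [])
    ∷ template C₄
        ((o ∷ o ∷ o ∷ l ∷ o ∷ []) ∷ (o ∷ o ∷ l ∷ o ∷ o ∷ []) ∷ (l ∷ o ∷ o ∷ l ∷ l ∷ []) ∷ [])
        ((o ∷ o ∷ o ∷ l ∷ o ∷ []) ∷ (o ∷ o ∷ l ∷ o ∷ o ∷ []) ∷ (l ∷ o ∷ o ∷ l ∷ l ∷ []) ∷ (l ∷ o ∷ l ∷ o ∷ l ∷ []) ∷ [])
        ((o ∷ o ∷ o ∷ o ∷ o ∷ []) ∷ (l ∷ o ∷ l ∷ l ∷ l ∷ []) ∷ (l ∷ o ∷ o ∷ o ∷ l ∷ []) ∷ (o ∷ o ∷ l ∷ l ∷ o ∷ []) ∷ [])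
    ∷ template C₄
        ((o ∷ o ∷ o ∷ l ∷ o ∷ []) ∷ (o ∷ o ∷ l ∷ o ∷ o ∷ []) ∷ (l ∷ l ∷ o ∷ l ∷ o ∷ []) ∷ [])
        ((o ∷ o ∷ o ∷ l ∷ o ∷ []) ∷ (o ∷ o ∷ l ∷ o ∷ o ∷ []) ∷ (l ∷ l ∷ o ∷ l ∷ o ∷ []) ∷ (l ∷ l ∷ l ∷ o ∷ o ∷ []) ∷ [])
        ((o ∷ o ∷ o ∷ o ∷ o ∷ []) ∷ (l ∷ l ∷ l ∷ l ∷ o ∷ []) ∷ (l ∷ l ∷ o ∷ o ∷ o ∷ []) ∷ (o ∷ o ∷ l ∷ l ∷ o ∷ []) ∷ [])
    ∷ template C₄
        ((o ∷ o ∷ o ∷ o ∷ l ∷ []) ∷ (o ∷ o ∷ o ∷ l ∷ o ∷ []) ∷ (o ∷ l ∷ l ∷ o ∷ o ∷ []) ∷ [])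
        ((o ∷ o ∷ o ∷ o ∷ l ∷ []) ∷ (o ∷ o ∷ o ∷ l ∷ o ∷ []) ∷ (o ∷ l ∷ l ∷ o ∷ o ∷ []) ∷ (o ∷ l ∷ l ∷ l ∷ l ∷ []) ∷ [])
        ((o ∷ o ∷ o ∷ o ∷ o ∷ []) ∷ (o ∷ l ∷ l ∷ l ∷ o ∷ []) ∷ (o ∷ l ∷ l ∷ o ∷ l ∷ []) ∷ (o ∷ o ∷ o ∷ l ∷ l ∷ []) ∷ [])
    ∷ template C₄
        ((o ∷ o ∷ o ∷ l ∷ l ∷ []) ∷ (o ∷ o ∷ l ∷ o ∷ o ∷ []) ∷ (o ∷ l ∷ o ∷ o ∷ o ∷ []) ∷ [])
        ((o ∷ o ∷ o ∷ l ∷ l ∷ []) ∷ (o ∷ o ∷ l ∷ o ∷ o ∷ []) ∷ (o ∷ l ∷ o ∷ o ∷ o ∷ []) ∷ (o ∷ l ∷ l ∷ l ∷ l ∷ []) ∷ [])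
        ((o ∷ o ∷ o ∷ o ∷ o ∷ []) ∷ (o ∷ l ∷ l ∷ o ∷ o ∷ []) ∷ (o ∷ l ∷ o ∷ l ∷ l ∷ []) ∷ (o ∷ o ∷ l ∷ l ∷ l ∷ []) ∷ [])
    ∷ template C₄
        ((o ∷ o ∷ o ∷ l ∷ l ∷ []) ∷ (o ∷ o ∷ l ∷ o ∷ l ∷ []) ∷ (o ∷ l ∷ o ∷ l ∷ o ∷ []) ∷ [])
        ((o ∷ o ∷ o ∷ l ∷ l ∷ []) ∷ (o ∷ o ∷ l ∷ o ∷ l ∷ []) ∷ (o ∷ l ∷ o ∷ l ∷ o ∷ []) ∷ (o ∷ l ∷ l ∷ o ∷ o ∷ []) ∷ [])
        ((o ∷ o ∷ o ∷ o ∷ o ∷ []) ∷ (o ∷ l ∷ l ∷ l ∷ l ∷ []) ∷ (o ∷ l ∷ o ∷ o ∷ l ∷ []) ∷ (o ∷ o ∷ l ∷ l ∷ o ∷ []) ∷ [])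
    ∷ template C₄
        ((o ∷ o ∷ o ∷ o ∷ l ∷ []) ∷ (o ∷ o ∷ l ∷ o ∷ o ∷ []) ∷ (o ∷ l ∷ o ∷ l ∷ o ∷ []) ∷ [])
        ((o ∷ o ∷ o ∷ o ∷ l ∷ []) ∷ (o ∷ o ∷ l ∷ o ∷ o ∷ []) ∷ (o ∷ l ∷ o ∷ l ∷ o ∷ []) ∷ (o ∷ l ∷ l ∷ l ∷ l ∷ []) ∷ [])
        ((o ∷ o ∷ o ∷ o ∷ o ∷ []) ∷ (o ∷ l ∷ l ∷ l ∷ o ∷ []) ∷ (o ∷ l ∷ o ∷ l ∷ l ∷ []) ∷ (o ∷ o ∷ l ∷ o ∷ l ∷ []) ∷ [])
    ∷ template C₄
        ((o ∷ o ∷ o ∷ l ∷ o ∷ []) ∷ (o ∷ o ∷ l ∷ o ∷ l ∷ []) ∷ (o ∷ l ∷ o ∷ o ∷ o ∷ []) ∷ [])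
        ((o ∷ o ∷ o ∷ l ∷ o ∷ []) ∷ (o ∷ o ∷ l ∷ o ∷ l ∷ []) ∷ (o ∷ l ∷ o ∷ o ∷ o ∷ []) ∷ (o ∷ l ∷ l ∷ l ∷ l ∷ []) ∷ [])
        ((o ∷ o ∷ o ∷ o ∷ o ∷ []) ∷ (o ∷ l ∷ l ∷ o ∷ l ∷ []) ∷ (o ∷ l ∷ o ∷ l ∷ o ∷ []) ∷ (o ∷ o ∷ l ∷ l ∷ l ∷ []) ∷ [])
    ∷ template C₄
        ((o ∷ o ∷ o ∷ o ∷ l ∷ []) ∷ (o ∷ o ∷ o ∷ l ∷ o ∷ []) ∷ (l ∷ l ∷ l ∷ o ∷ o ∷ []) ∷ [])
        ((o ∷ o ∷ o ∷ o ∷ l ∷ []) ∷ (o ∷ o ∷ o ∷ l ∷ o ∷ []) ∷ (l ∷ l ∷ l ∷ o ∷ o ∷ []) ∷ (l ∷ l ∷ l ∷ l ∷ l ∷ []) ∷ [])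
        ((o ∷ o ∷ o ∷ o ∷ o ∷ []) ∷ (l ∷ l ∷ l ∷ l ∷ o ∷ []) ∷ (l ∷ l ∷ l ∷ o ∷ l ∷ []) ∷ (o ∷ o ∷ o ∷ l ∷ l ∷ []) ∷ [])
    ∷ template C₄
        ((o ∷ o ∷ o ∷ o ∷ l ∷ []) ∷ (o ∷ o ∷ l ∷ o ∷ o ∷ []) ∷ (l ∷ l ∷ o ∷ l ∷ o ∷ []) ∷ [])
        ((o ∷ o ∷ o ∷ o ∷ l ∷ []) ∷ (o ∷ o ∷ l ∷ o ∷ o ∷ []) ∷ (l ∷ l ∷ o ∷ l ∷ o ∷ []) ∷ (l ∷ l ∷ l ∷ l ∷ l ∷ []) ∷ [])
        ((o ∷ o ∷ o ∷ o ∷ o ∷ []) ∷ (l ∷ l ∷ l ∷ l ∷ o ∷ []) ∷ (l ∷ l ∷ o ∷ l ∷ l ∷ []) ∷ (o ∷ o ∷ l ∷ o ∷ l ∷ []) ∷ [])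
    ∷ template K₃₃*
        ((o ∷ o ∷ o ∷ o ∷ l ∷ []) ∷ (o ∷ o ∷ o ∷ l ∷ o ∷ []) ∷ (o ∷ o ∷ l ∷ o ∷ o ∷ []) ∷ (l ∷ l ∷ o ∷ o ∷ o ∷ []) ∷ [])
        ((l ∷ l ∷ l ∷ l ∷ l ∷ []) ∷ (o ∷ o ∷ l ∷ o ∷ l ∷ []) ∷ (l ∷ l ∷ o ∷ l ∷ o ∷ []) ∷ (o ∷ o ∷ o ∷ l ∷ l ∷ []) ∷
         (l ∷ l ∷ l ∷ o ∷ o ∷ []) ∷ (o ∷ o ∷ o ∷ o ∷ l ∷ []) ∷ (o ∷ o ∷ o ∷ l ∷ o ∷ []) ∷ (o ∷ o ∷ l ∷ o ∷ o ∷ []) ∷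
         (l ∷ l ∷ o ∷ o ∷ o ∷ []) ∷ [])
        ((o ∷ o ∷ o ∷ o ∷ o ∷ []) ∷ (o ∷ o ∷ l ∷ l ∷ o ∷ []) ∷ (l ∷ l ∷ l ∷ l ∷ o ∷ []) ∷ (l ∷ l ∷ o ∷ o ∷ l ∷ []) ∷
         (l ∷ l ∷ l ∷ o ∷ l ∷ []) ∷ (l ∷ l ∷ o ∷ l ∷ l ∷ []) ∷ (o ∷ o ∷ l ∷ l ∷ l ∷ []) ∷ [])
    ∷ template K₃₃*
        ((o ∷ o ∷ o ∷ o ∷ l ∷ []) ∷ (o ∷ o ∷ o ∷ l ∷ o ∷ []) ∷ (l ∷ o ∷ l ∷ o ∷ o ∷ []) ∷ (o ∷ l ∷ o ∷ o ∷ o ∷ []) ∷ [])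
        ((l ∷ l ∷ l ∷ l ∷ l ∷ []) ∷ (l ∷ o ∷ l ∷ o ∷ l ∷ []) ∷ (o ∷ l ∷ o ∷ l ∷ o ∷ []) ∷ (o ∷ o ∷ o ∷ l ∷ l ∷ []) ∷
         (l ∷ l ∷ l ∷ o ∷ o ∷ []) ∷ (o ∷ o ∷ o ∷ o ∷ l ∷ []) ∷ (o ∷ o ∷ o ∷ l ∷ o ∷ []) ∷ (l ∷ o ∷ l ∷ o ∷ o ∷ []) ∷
         (o ∷ l ∷ o ∷ o ∷ o ∷ []) ∷ [])
        ((o ∷ o ∷ o ∷ o ∷ o ∷ []) ∷ (l ∷ o ∷ l ∷ l ∷ o ∷ []) ∷ (l ∷ l ∷ l ∷ l ∷ o ∷ []) ∷ (o ∷ l ∷ o ∷ o ∷ l ∷ []) ∷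
         (l ∷ l ∷ l ∷ o ∷ l ∷ []) ∷ (o ∷ l ∷ o ∷ l ∷ l ∷ []) ∷ (l ∷ o ∷ l ∷ l ∷ l ∷ []) ∷ [])
    ∷ template K₃₃*
        ((o ∷ o ∷ o ∷ o ∷ l ∷ []) ∷ (o ∷ o ∷ l ∷ o ∷ o ∷ []) ∷ (l ∷ o ∷ o ∷ l ∷ o ∷ []) ∷ (o ∷ l ∷ o ∷ o ∷ o ∷ []) ∷ [])
        ((l ∷ l ∷ l ∷ l ∷ l ∷ []) ∷ (l ∷ o ∷ o ∷ l ∷ l ∷ []) ∷ (o ∷ l ∷ l ∷ o ∷ o ∷ []) ∷ (o ∷ o ∷ l ∷ o ∷ l ∷ []) ∷
         (l ∷ l ∷ o ∷ l ∷ o ∷ []) ∷ (o ∷ o ∷ o ∷ o ∷ l ∷ []) ∷ (o ∷ o ∷ l ∷ o ∷ o ∷ []) ∷ (l ∷ o ∷ o ∷ l ∷ o ∷ []) ∷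
         (o ∷ l ∷ o ∷ o ∷ o ∷ []) ∷ [])
        ((o ∷ o ∷ o ∷ o ∷ o ∷ []) ∷ (l ∷ o ∷ l ∷ l ∷ o ∷ []) ∷ (l ∷ l ∷ l ∷ l ∷ o ∷ []) ∷ (o ∷ l ∷ o ∷ o ∷ l ∷ []) ∷
         (l ∷ l ∷ o ∷ l ∷ l ∷ []) ∷ (o ∷ l ∷ l ∷ o ∷ l ∷ []) ∷ (l ∷ o ∷ l ∷ l ∷ l ∷ []) ∷ [])
    ∷ template C₄
        ((o ∷ o ∷ o ∷ l ∷ l ∷ []) ∷ (o ∷ l ∷ l ∷ o ∷ o ∷ []) ∷ (l ∷ o ∷ o ∷ o ∷ o ∷ []) ∷ [])
        ((o ∷ o ∷ o ∷ l ∷ l ∷ []) ∷ (o ∷ l ∷ l ∷ o ∷ o ∷ []) ∷ (l ∷ o ∷ o ∷ o ∷ o ∷ []) ∷ (l ∷ l ∷ l ∷ l ∷ l ∷ []) ∷ [])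
        ((o ∷ o ∷ o ∷ o ∷ o ∷ []) ∷ (l ∷ l ∷ l ∷ o ∷ o ∷ []) ∷ (l ∷ o ∷ o ∷ l ∷ l ∷ []) ∷ (o ∷ l ∷ l ∷ l ∷ l ∷ []) ∷ [])
    ∷ template C₄
        ((o ∷ o ∷ l ∷ o ∷ l ∷ []) ∷ (o ∷ l ∷ o ∷ l ∷ o ∷ []) ∷ (l ∷ o ∷ o ∷ o ∷ o ∷ []) ∷ [])
        ((o ∷ o ∷ l ∷ o ∷ l ∷ []) ∷ (o ∷ l ∷ o ∷ l ∷ o ∷ []) ∷ (l ∷ o ∷ o ∷ o ∷ o ∷ []) ∷ (l ∷ l ∷ l ∷ l ∷ l ∷ []) ∷ [])
        ((o ∷ o ∷ o ∷ o ∷ o ∷ []) ∷ (l ∷ l ∷ o ∷ l ∷ o ∷ []) ∷ (l ∷ o ∷ l ∷ o ∷ l ∷ []) ∷ (o ∷ l ∷ l ∷ l ∷ l ∷ []) ∷ [])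
    ∷ template K₃₃*
        ((o ∷ o ∷ o ∷ l ∷ o ∷ []) ∷ (o ∷ l ∷ o ∷ o ∷ o ∷ []) ∷ (l ∷ o ∷ o ∷ o ∷ l ∷ []) ∷ (o ∷ o ∷ l ∷ o ∷ o ∷ []) ∷ [])
        ((l ∷ l ∷ l ∷ l ∷ l ∷ []) ∷ (l ∷ o ∷ o ∷ l ∷ l ∷ []) ∷ (o ∷ l ∷ l ∷ o ∷ o ∷ []) ∷ (o ∷ l ∷ o ∷ l ∷ o ∷ []) ∷
         (l ∷ o ∷ l ∷ o ∷ l ∷ []) ∷ (o ∷ o ∷ o ∷ l ∷ o ∷ []) ∷ (o ∷ l ∷ o ∷ o ∷ o ∷ []) ∷ (l ∷ o ∷ o ∷ o ∷ l ∷ []) ∷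
         (o ∷ o ∷ l ∷ o ∷ o ∷ []) ∷ [])
        ((o ∷ o ∷ o ∷ o ∷ o ∷ []) ∷ (l ∷ l ∷ o ∷ o ∷ l ∷ []) ∷ (l ∷ l ∷ l ∷ o ∷ l ∷ []) ∷ (o ∷ o ∷ l ∷ l ∷ o ∷ []) ∷
         (l ∷ o ∷ l ∷ l ∷ l ∷ []) ∷ (o ∷ l ∷ l ∷ l ∷ o ∷ []) ∷ (l ∷ l ∷ o ∷ l ∷ l ∷ []) ∷ [])
    ∷ template K₃₃*
        ((o ∷ o ∷ o ∷ o ∷ l ∷ []) ∷ (o ∷ o ∷ o ∷ l ∷ o ∷ []) ∷ (l ∷ o ∷ l ∷ o ∷ o ∷ []) ∷ (l ∷ l ∷ o ∷ o ∷ o ∷ []) ∷ [])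
        ((o ∷ l ∷ l ∷ l ∷ l ∷ []) ∷ (l ∷ o ∷ l ∷ o ∷ l ∷ []) ∷ (l ∷ l ∷ o ∷ l ∷ o ∷ []) ∷ (o ∷ o ∷ o ∷ l ∷ l ∷ []) ∷
         (o ∷ l ∷ l ∷ o ∷ o ∷ []) ∷ (o ∷ o ∷ o ∷ o ∷ l ∷ []) ∷ (o ∷ o ∷ o ∷ l ∷ o ∷ []) ∷ (l ∷ o ∷ l ∷ o ∷ o ∷ []) ∷
         (l ∷ l ∷ o ∷ o ∷ o ∷ []) ∷ [])
        ((o ∷ o ∷ o ∷ o ∷ o ∷ []) ∷ (l ∷ o ∷ l ∷ l ∷ o ∷ []) ∷ (o ∷ l ∷ l ∷ l ∷ o ∷ []) ∷ (l ∷ l ∷ o ∷ o ∷ l ∷ []) ∷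
         (o ∷ l ∷ l ∷ o ∷ l ∷ []) ∷ (l ∷ l ∷ o ∷ l ∷ l ∷ []) ∷ (l ∷ o ∷ l ∷ l ∷ l ∷ []) ∷ [])
    ∷ template K₃₃*
        ((o ∷ o ∷ o ∷ o ∷ l ∷ []) ∷ (o ∷ o ∷ l ∷ o ∷ o ∷ []) ∷ (l ∷ o ∷ o ∷ l ∷ o ∷ []) ∷ (l ∷ l ∷ o ∷ o ∷ o ∷ []) ∷ [])
        ((o ∷ l ∷ l ∷ l ∷ l ∷ []) ∷ (l ∷ o ∷ o ∷ l ∷ l ∷ []) ∷ (l ∷ l ∷ l ∷ o ∷ o ∷ []) ∷ (o ∷ o ∷ l ∷ o ∷ l ∷ []) ∷
         (o ∷ l ∷ o ∷ l ∷ o ∷ []) ∷ (o ∷ o ∷ o ∷ o ∷ l ∷ []) ∷ (o ∷ o ∷ l ∷ o ∷ o ∷ []) ∷ (l ∷ o ∷ o ∷ l ∷ o ∷ []) ∷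
         (l ∷ l ∷ o ∷ o ∷ o ∷ []) ∷ [])
        ((o ∷ o ∷ o ∷ o ∷ o ∷ []) ∷ (l ∷ o ∷ l ∷ l ∷ o ∷ []) ∷ (o ∷ l ∷ l ∷ l ∷ o ∷ []) ∷ (l ∷ l ∷ o ∷ o ∷ l ∷ []) ∷
         (o ∷ l ∷ o ∷ l ∷ l ∷ []) ∷ (l ∷ l ∷ l ∷ o ∷ l ∷ []) ∷ (l ∷ o ∷ l ∷ l ∷ l ∷ []) ∷ [])
    ∷ template K₃₃*
        ((o ∷ o ∷ o ∷ l ∷ o ∷ []) ∷ (o ∷ l ∷ o ∷ o ∷ o ∷ []) ∷ (l ∷ o ∷ o ∷ o ∷ l ∷ []) ∷ (l ∷ o ∷ l ∷ o ∷ o ∷ []) ∷ [])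
        ((o ∷ l ∷ l ∷ l ∷ l ∷ []) ∷ (l ∷ o ∷ o ∷ l ∷ l ∷ []) ∷ (l ∷ l ∷ l ∷ o ∷ o ∷ []) ∷ (o ∷ l ∷ o ∷ l ∷ o ∷ []) ∷
         (o ∷ o ∷ l ∷ o ∷ l ∷ []) ∷ (o ∷ o ∷ o ∷ l ∷ o ∷ []) ∷ (o ∷ l ∷ o ∷ o ∷ o ∷ []) ∷ (l ∷ o ∷ o ∷ o ∷ l ∷ []) ∷
         (l ∷ o ∷ l ∷ o ∷ o ∷ []) ∷ [])
        ((o ∷ o ∷ o ∷ o ∷ o ∷ []) ∷ (l ∷ l ∷ o ∷ o ∷ l ∷ []) ∷ (o ∷ l ∷ l ∷ o ∷ l ∷ []) ∷ (l ∷ o ∷ l ∷ l ∷ o ∷ []) ∷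
         (o ∷ o ∷ l ∷ l ∷ l ∷ []) ∷ (l ∷ l ∷ l ∷ l ∷ o ∷ []) ∷ (l ∷ l ∷ o ∷ l ∷ l ∷ []) ∷ [])
    ∷ template K₃₃*
        ((o ∷ o ∷ o ∷ l ∷ l ∷ []) ∷ (o ∷ l ∷ l ∷ o ∷ o ∷ []) ∷ (l ∷ o ∷ o ∷ o ∷ l ∷ []) ∷ (o ∷ o ∷ l ∷ o ∷ o ∷ []) ∷ [])
        ((l ∷ l ∷ o ∷ l ∷ o ∷ []) ∷ (l ∷ o ∷ o ∷ l ∷ o ∷ []) ∷ (o ∷ l ∷ o ∷ o ∷ o ∷ []) ∷ (o ∷ l ∷ l ∷ l ∷ l ∷ []) ∷
         (l ∷ o ∷ l ∷ o ∷ l ∷ []) ∷ (o ∷ o ∷ o ∷ l ∷ l ∷ []) ∷ (o ∷ l ∷ l ∷ o ∷ o ∷ []) ∷ (l ∷ o ∷ o ∷ o ∷ l ∷ []) ∷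
         (o ∷ o ∷ l ∷ o ∷ o ∷ []) ∷ [])
        ((o ∷ o ∷ o ∷ o ∷ o ∷ []) ∷ (l ∷ l ∷ l ∷ o ∷ l ∷ []) ∷ (l ∷ l ∷ o ∷ o ∷ l ∷ []) ∷ (o ∷ o ∷ l ∷ l ∷ l ∷ []) ∷
         (l ∷ o ∷ l ∷ l ∷ o ∷ []) ∷ (o ∷ l ∷ o ∷ l ∷ l ∷ []) ∷ (l ∷ l ∷ l ∷ l ∷ o ∷ []) ∷ [])
    ∷ template C₄
        ((o ∷ o ∷ o ∷ o ∷ l ∷ []) ∷ (o ∷ o ∷ o ∷ l ∷ o ∷ []) ∷ (l ∷ o ∷ o ∷ o ∷ o ∷ []) ∷ [])
        ((o ∷ o ∷ o ∷ o ∷ l ∷ []) ∷ (o ∷ o ∷ o ∷ l ∷ o ∷ []) ∷ (l ∷ o ∷ o ∷ o ∷ o ∷ []) ∷ (l ∷ o ∷ o ∷ l ∷ l ∷ []) ∷ [])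
        ((o ∷ o ∷ o ∷ o ∷ o ∷ []) ∷ (l ∷ o ∷ o ∷ l ∷ o ∷ []) ∷ (l ∷ o ∷ o ∷ o ∷ l ∷ []) ∷ (o ∷ o ∷ o ∷ l ∷ l ∷ []) ∷ [])
    ∷ template C₄
        ((o ∷ o ∷ o ∷ o ∷ l ∷ []) ∷ (o ∷ o ∷ l ∷ o ∷ o ∷ []) ∷ (l ∷ o ∷ o ∷ o ∷ o ∷ []) ∷ [])
        ((o ∷ o ∷ o ∷ o ∷ l ∷ []) ∷ (o ∷ o ∷ l ∷ o ∷ o ∷ []) ∷ (l ∷ o ∷ o ∷ o ∷ o ∷ []) ∷ (l ∷ o ∷ l ∷ o ∷ l ∷ []) ∷ [])
        ((o ∷ o ∷ o ∷ o ∷ o ∷ []) ∷ (l ∷ o ∷ l ∷ o ∷ o ∷ []) ∷ (l ∷ o ∷ o ∷ o ∷ l ∷ []) ∷ (o ∷ o ∷ l ∷ o ∷ l ∷ []) ∷ [])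
    ∷ template C₄
        ((o ∷ o ∷ o ∷ l ∷ o ∷ []) ∷ (o ∷ l ∷ o ∷ o ∷ o ∷ []) ∷ (l ∷ o ∷ o ∷ o ∷ o ∷ []) ∷ [])
        ((o ∷ o ∷ o ∷ l ∷ o ∷ []) ∷ (o ∷ l ∷ o ∷ o ∷ o ∷ []) ∷ (l ∷ o ∷ o ∷ o ∷ o ∷ []) ∷ (l ∷ l ∷ o ∷ l ∷ o ∷ []) ∷ [])
        ((o ∷ o ∷ o ∷ o ∷ o ∷ []) ∷ (l ∷ l ∷ o ∷ o ∷ o ∷ []) ∷ (l ∷ o ∷ o ∷ l ∷ o ∷ []) ∷ (o ∷ l ∷ o ∷ l ∷ o ∷ []) ∷ [])
    ∷ template C₄
        ((o ∷ o ∷ l ∷ o ∷ o ∷ []) ∷ (o ∷ l ∷ o ∷ o ∷ o ∷ []) ∷ (l ∷ o ∷ o ∷ o ∷ o ∷ []) ∷ [])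
        ((o ∷ o ∷ l ∷ o ∷ o ∷ []) ∷ (o ∷ l ∷ o ∷ o ∷ o ∷ []) ∷ (l ∷ o ∷ o ∷ o ∷ o ∷ []) ∷ (l ∷ l ∷ l ∷ o ∷ o ∷ []) ∷ [])
        ((o ∷ o ∷ o ∷ o ∷ o ∷ []) ∷ (l ∷ l ∷ o ∷ o ∷ o ∷ []) ∷ (l ∷ o ∷ l ∷ o ∷ o ∷ []) ∷ (o ∷ l ∷ l ∷ o ∷ o ∷ []) ∷ [])
    ∷ template C₄
        ((o ∷ o ∷ o ∷ o ∷ l ∷ []) ∷ (o ∷ l ∷ o ∷ l ∷ o ∷ []) ∷ (l ∷ o ∷ o ∷ l ∷ l ∷ []) ∷ [])
        ((o ∷ o ∷ o ∷ o ∷ l ∷ []) ∷ (o ∷ l ∷ o ∷ l ∷ o ∷ []) ∷ (l ∷ o ∷ o ∷ l ∷ l ∷ []) ∷ (l ∷ l ∷ o ∷ o ∷ o ∷ []) ∷ [])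
        ((o ∷ o ∷ o ∷ o ∷ o ∷ []) ∷ (l ∷ l ∷ o ∷ o ∷ l ∷ []) ∷ (l ∷ o ∷ o ∷ l ∷ o ∷ []) ∷ (o ∷ l ∷ o ∷ l ∷ l ∷ []) ∷ [])
    ∷ template C₄
        ((o ∷ o ∷ o ∷ o ∷ l ∷ []) ∷ (o ∷ l ∷ l ∷ o ∷ o ∷ []) ∷ (l ∷ o ∷ l ∷ o ∷ l ∷ []) ∷ [])
        ((o ∷ o ∷ o ∷ o ∷ l ∷ []) ∷ (o ∷ l ∷ l ∷ o ∷ o ∷ []) ∷ (l ∷ o ∷ l ∷ o ∷ l ∷ []) ∷ (l ∷ l ∷ o ∷ o ∷ o ∷ []) ∷ [])
        ((o ∷ o ∷ o ∷ o ∷ o ∷ []) ∷ (l ∷ l ∷ o ∷ o ∷ l ∷ []) ∷ (l ∷ o ∷ l ∷ o ∷ o ∷ []) ∷ (o ∷ l ∷ l ∷ o ∷ l ∷ []) ∷ [])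
    ∷ template C₄
        ((o ∷ o ∷ o ∷ l ∷ o ∷ []) ∷ (o ∷ o ∷ l ∷ o ∷ l ∷ []) ∷ (l ∷ o ∷ o ∷ l ∷ l ∷ []) ∷ [])
        ((o ∷ o ∷ o ∷ l ∷ o ∷ []) ∷ (o ∷ o ∷ l ∷ o ∷ l ∷ []) ∷ (l ∷ o ∷ o ∷ l ∷ l ∷ []) ∷ (l ∷ o ∷ l ∷ o ∷ o ∷ []) ∷ [])
        ((o ∷ o ∷ o ∷ o ∷ o ∷ []) ∷ (l ∷ o ∷ l ∷ l ∷ o ∷ []) ∷ (l ∷ o ∷ o ∷ o ∷ l ∷ []) ∷ (o ∷ o ∷ l ∷ l ∷ l ∷ []) ∷ [])
    ∷ template C₄
        ((o ∷ o ∷ o ∷ l ∷ o ∷ []) ∷ (o ∷ l ∷ l ∷ o ∷ o ∷ []) ∷ (l ∷ o ∷ l ∷ o ∷ o ∷ []) ∷ [])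
        ((o ∷ o ∷ o ∷ l ∷ o ∷ []) ∷ (o ∷ l ∷ l ∷ o ∷ o ∷ []) ∷ (l ∷ o ∷ l ∷ o ∷ o ∷ []) ∷ (l ∷ l ∷ o ∷ l ∷ o ∷ []) ∷ [])
        ((o ∷ o ∷ o ∷ o ∷ o ∷ []) ∷ (l ∷ l ∷ o ∷ o ∷ o ∷ []) ∷ (l ∷ o ∷ l ∷ l ∷ o ∷ []) ∷ (o ∷ l ∷ l ∷ l ∷ o ∷ []) ∷ [])
    ∷ template K₄
        ((o ∷ o ∷ o ∷ o ∷ l ∷ []) ∷ (l ∷ o ∷ o ∷ o ∷ o ∷ []) ∷ (l ∷ o ∷ o ∷ l ∷ o ∷ []) ∷ [])
        ((o ∷ o ∷ o ∷ o ∷ l ∷ []) ∷ (l ∷ o ∷ o ∷ o ∷ o ∷ []) ∷ (l ∷ o ∷ o ∷ l ∷ o ∷ []) ∷ (l ∷ o ∷ o ∷ o ∷ l ∷ []) ∷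
         (l ∷ o ∷ o ∷ l ∷ l ∷ []) ∷ (o ∷ o ∷ o ∷ l ∷ o ∷ []) ∷ [])
        ((o ∷ o ∷ o ∷ o ∷ o ∷ []) ∷ (o ∷ o ∷ o ∷ l ∷ l ∷ []) ∷ [])
    ∷ []

templates-valid : all valid templates ≡ true
templates-valid = refl

template-exists : ∀ εs twins → ∃ λ τ → valid τ ≡ true × fits εs twins τ ≡ true
template-exists εs twins with findTemplate εs twins templates in found
... | just τ  = τ , findTemplate-sound εs twins templates τ templates-valid found
... | nothing = ⊥-elim (true≢false (trans (sym every-configuration-fitted) (cong is-just found)))
  where
  every-configuration-fitted : is-just (findTemplate εs twins templates) ≡ true
  every-configuration-fitted =
    allVecᵇ-sound 9 (λ twins → is-just (findTemplate εs twins templates))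
      (allVecᵇ-sound 5 (λ εs → allVecᵇ 9 (λ twins → is-just (findTemplate εs twins templates))) refl εs) twins

module Coordinates {m r} (v : Fin m → GF2^ r) (simple : Simple (VecMatroid v)) (e : Fin m)
  (R : Sub m) (reps : SiReps (Contract (VecMatroid v) e) R)
  (F : Sub m) (F-flat : Flat (Restrict (Contract (VecMatroid v) e) R) F)
  (iso : Iso (Restrict (Restrict (Contract (VecMatroid v) e) R) F) MK33*) where

  N|F : Matroid m
  N|F = Restrict (Restrict (Contract (VecMatroid v) e) R) F

  f : Fin m → Fin 9
  f = proj₁ iso

  p : Fin 9 → Fin m
  p = proj₁ (proj₂ iso)

  p∈F : ∀ k → F (p k) ≡ true
  p∈F k = proj₁ (proj₂ (proj₂ (proj₂ iso))) k refl

  p∘f : ∀ i → F i ≡ true → p (f i) ≡ i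
  p∘f = proj₁ (proj₂ (proj₂ (proj₂ (proj₂ iso))))

  f∘p : ∀ k → f (p k) ≡ k
  f∘p k = proj₁ (proj₂ (proj₂ (proj₂ (proj₂ (proj₂ iso))))) k refl

  pullback : Sub 9 → Sub m
  pullback Y i = F i ∧ Y (f i)

  pullback-independence : ∀ Y → (Ind MK33* Y → Ind N|F (pullback Y)) × (Ind N|F (pullback Y) → Ind MK33* Y)
  pullback-independence Y = proj₂ (proj₂ (proj₂ (proj₂ (proj₂ (proj₂ iso))))) Y (λ _ _ → refl)

  p-injective : Injective _≡_ _≡_ p
  p-injective {k} {k'} pk≡pk' = trans (sym (f∘p k)) (trans (cong f pk≡pk') (f∘p k'))

  p≢e : ∀ k → p k ≢ e
  p≢e k = ∈E/e⇒≢ (proj₁ reps _ (proj₁ F-flat _ (p∈F k)))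

  -- P enumerates e, p₀, …, p₈, so that `true ◂ Y` stands for {e} ∪ p[Y].
  P : Fin 10 → Fin m
  P zero    = e
  P (suc k) = p k

  P-injective : Injective _≡_ _≡_ P
  P-injective {zero}  {zero}   _ = refl
  P-injective {zero}  {suc k}  e≡pk = ⊥-elim (p≢e k (sym e≡pk))
  P-injective {suc k} {zero}   pk≡e = ⊥-elim (p≢e k pk≡e)
  P-injective {suc k} {suc k'} pk≡pk' = cong suc (p-injective pk≡pk')

  V : Fin 10 → GF2^ r
  V = v ∘ P

  pullback∪e≗image : ∀ Y i → (pullback Y i ∨ ｛ e ｝ i) ≡ image P (true ◂ Y) i
  pullback∪e≗image Y i with i ≟ e
  ... | yes refl rewrite ∨-zeroʳ (pullback Y i) | image-outside p Y i p≢e = refl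
  ... | no _ rewrite ∨-identityʳ (pullback Y i) with F i in Fi
  ...   | true = trans (sym (image-at p Y p-injective (f i))) (cong (image p Y) (p∘f i Fi))
  ...   | false = sym (image-outside p Y i (λ k pk≡i → true≢false (trans (sym (p∈F k)) (trans (cong F pk≡i) Fi))))

  transfer⁺ : ∀ Y → LinIndep u Y → LinIndep V (true ◂ Y)
  transfer⁺ Y li = LinIndep-image⁻ v P (true ◂ Y) P-injective
    (LinIndep-congʳ v (pullback∪e≗image Y) (proj₂ (proj₂ (proj₂ (proj₁ (pullback-independence Y) li)))))

  transfer⁻ : ∀ Y → LinIndep V (true ◂ Y) → LinIndep u Y
  transfer⁻ Y li = proj₂ (pullback-independence Y)
    ( (λ i h → ∧-conicalˡ _ _ h)
    , (λ i h → proj₁ F-flat i (∧-conicalˡ _ _ h))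
    , (λ i h → proj₁ reps i (proj₁ F-flat i (∧-conicalˡ _ _ h)))
    , LinIndep-congʳ v (sym ∘ pullback∪e≗image Y) (LinIndep-image⁺ v P (true ◂ Y) P-injective li))

  ι : Fin 5 → Fin 10
  ι zero    = zero
  ι (suc l) = suc (basis l)

  ι-injective : Injective _≡_ _≡_ ι
  ι-injective {zero}  {zero}  _ = refl
  ι-injective {suc l} {suc l'} h = cong suc (basis-injective (suc-injective h))

  image-ι : ∀ t x i → image ι (lookup (t ∷ x)) i ≡ (t ◂ onBasis x) i
  image-ι t x zero = trans
    (cong₂ _xor_ (∧-identityʳ t) (image-outside (ι ∘ suc) (lookup x) zero (λ _ ())))
    (xor-identityʳ t)
  image-ι t x (suc k) = trans (cong (_xor image (ι ∘ suc) (lookup x) (suc k)) (∧-zeroʳ t)) (image-suc basis (lookup x) k)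

  -- coordinates with respect to e, p₅, p₆, p₇, p₈
  Φ : GF2^ 5 → GF2^ r
  Φ c = sumOver (V ∘ ι) (lookup c)

  Φ-linear : Linear Φ
  Φ-linear = combination-linear (V ∘ ι)

  Φ≡sumOver-image : ∀ c → Φ c ≡ sumOver V (image ι (lookup c))
  Φ≡sumOver-image c = sym (sumOver-image V ι (lookup c))

  frame-independent : LinIndep (V ∘ ι) (lookup (replicate 5 true))
  frame-independent = LinIndep-image⁻ V ι _ ι-injective
    (LinIndep-congʳ V (sym ∘ image-ι true (replicate 4 true)) (transfer⁺ _ basis-independent))

  Φ-kernel : ∀ c → Φ c ≡ 0v → c ≡ 0v
  Φ-kernel c Φc≡0 = trans (sym (tabulate∘lookup c))
    (tabulate-cong (frame-independent (lookup c) (λ l _ → lookup-replicate l true) Φc≡0))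

  Φ-injective : ∀ c c' → Φ c ≡ Φ c' → c ≡ c'
  Φ-injective = Linear.injective Φ-linear Φ-kernel

  Φ-e : Φ (true ∷ 0v) ≡ v e
  Φ-e = sumOver-unit (V ∘ ι) zero

  Φ-basis : ∀ l → Φ (false ∷ u (basis l)) ≡ v (p (basis l))
  Φ-basis l = begin
    Φ (false ∷ u (basis l))         ≡⟨ cong (Φ ∘ (false ∷_)) (basis-unit l) ⟩
    Φ (false ∷ tabulate ｛ l ｝)     ≡⟨ cong Φ (cong (false ∷_) (tabulate-cong (λ k → sym (｛suc｝-suc k l)))) ⟩
    Φ (tabulate ｛ suc l ｝)         ≡⟨ sumOver-unit (V ∘ ι) (suc l) ⟩
    v (p (basis l))                 ∎
    where open ≡-Reasoning

  sumOver-⊆frame : ∀ Z Y → Z ⊆ image ι Y → sumOver V Z ≡ Φ (tabulate (Z ∘ ι))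
  sumOver-⊆frame Z Y Z⊆ = begin
    sumOver V Z                  ≡⟨ sumOver-congʳ V (image-preimage ι Y Z ι-injective Z⊆) ⟩
    sumOver V (image ι (Z ∘ ι))  ≡⟨ sumOver-image V ι (Z ∘ ι) ⟩
    sumOver (V ∘ ι) (Z ∘ ι)      ≡⟨ sumOver-congʳ (V ∘ ι) (sym ∘ lookup∘tabulate (Z ∘ ι)) ⟩
    Φ (tabulate (Z ∘ ι))         ∎
    where open ≡-Reasoning

  relation⇒dependent : ∀ k t x → v (p (nonbasis k)) ≡ Φ (t ∷ x) → ¬ LinIndep u (｛ nonbasis k ｝ ∪ onBasis x)
  relation⇒dependent k t x vk≡Φ li =
    in-span⇒dependent V (true ◂ (｛ k' ｝ ∪ onBasis x)) (image ι (lookup (t ∷ x))) (suc k')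
      Z⊆ (cong (_∨ onBasis x k') (｛｝-self k')) k∉Z (trans vk≡Φ (Φ≡sumOver-image (t ∷ x))) (transfer⁺ _ li)
    where
    k' : Fin 9
    k' = nonbasis k
    Z⊆ : image ι (lookup (t ∷ x)) ⊆ (true ◂ (｛ k' ｝ ∪ onBasis x))
    Z⊆ zero    _ = refl
    Z⊆ (suc j) h rewrite trans (sym (image-ι t x (suc j))) h = ∨-zeroʳ (｛ k' ｝ j)
    k∉Z : image ι (lookup (t ∷ x)) (suc k') ≡ false
    k∉Z = image-outside ι (lookup (t ∷ x)) (suc k') λ { zero () ; (suc l) h → basis≢nonbasis l k (suc-injective h) }

  nonbasis-in-span : ∀ k → ¬ (∀ t → v (p (nonbasis k)) ≢ Φ (t ∷ u (nonbasis k)))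
  nonbasis-in-span k ∉span = fundamental-circuit-dependent k
    (transfer⁻ (fundamental-circuit k) (LinIndep-congʳ V circuit≗ (LinIndep-∪-｛｝ V I (suc k') I-independent premise)))
    where
    k' : Fin 9
    k' = nonbasis k
    I : Sub 10
    I = true ◂ onBasis (u k')
    I≗ : ∀ i → image ι (lookup (true ∷ u k')) i ≡ I i
    I≗ = image-ι true (u k')
    I-independent : LinIndep V I
    I-independent = LinIndep-congʳ V I≗ (LinIndep-image⁺ V ι (lookup (true ∷ u k')) ι-injective
                      (LinIndep-⊆ (V ∘ ι) (λ l _ → lookup-replicate l true) frame-independent))
    circuit≗ : ∀ i → (I ∪ ｛ suc k' ｝) i ≡ (true ◂ fundamental-circuit k) i
    circuit≗ zero    = refl
    circuit≗ (suc j) = trans (cong (onBasis (u k') j ∨_) (｛suc｝-suc j k')) (∨-comm (onBasis (u k') j) (｛ k' ｝ j))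
    premise : ∀ Z → Z ⊆ I → V (suc k') ≢ sumOver V Z
    premise Z Z⊆I vk≡ΣZ = decide (x ≟ᵛ u k')
      where
      x : GF2^ 4
      x = tabulate (Z ∘ ι ∘ suc)
      vk≡Φ : v (p k') ≡ Φ (Z zero ∷ x)
      vk≡Φ = trans vk≡ΣZ (sumOver-⊆frame Z (lookup (true ∷ u k')) (λ i Zi → trans (I≗ i) (Z⊆I i Zi)))
      x⊑uk : x ⊑ u k'
      x⊑uk l xl = trans (sym (image-at basis (lookup (u k')) basis-injective l))
                        (Z⊆I (suc (basis l)) (trans (sym (lookup∘tabulate (Z ∘ ι ∘ suc) l)) xl))
      decide : Dec (x ≡ u k') → ⊥
      decide (yes x≡uk) = ∉span (Z zero) (trans vk≡Φ (cong (Φ ∘ (Z zero ∷_)) x≡uk))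
      decide (no x≢uk)  = relation⇒dependent k (Z zero) x vk≡Φ (fundamental-circuit-minimal k x x⊑uk x≢uk)

  nonbasis-coordinates : ∀ k → ∃ λ t → v (p (nonbasis k)) ≡ Φ (t ∷ u (nonbasis k))
  nonbasis-coordinates k with v (p (nonbasis k)) ≟ᵛ Φ (true ∷ u (nonbasis k))
                            | v (p (nonbasis k)) ≟ᵛ Φ (false ∷ u (nonbasis k))
  ... | yes vk≡Φ₁ | _         = true , vk≡Φ₁
  ... | no _      | yes vk≡Φ₀ = false , vk≡Φ₀
  ... | no vk≢Φ₁  | no vk≢Φ₀  = ⊥-elim (nonbasis-in-span k λ { true → vk≢Φ₁ ; false → vk≢Φ₀ })

  -- Opaque: letting ε unfold into the proof of `coordinates` makes type checking very slow.
  opaque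
    coordinates : ∀ k → ∃ λ t → v (p k) ≡ Φ (t ∷ u k)
    coordinates = nonbasis-or-basis (λ k → ∃ λ t → v (p k) ≡ Φ (t ∷ u k))
                    nonbasis-coordinates (λ l → false , sym (Φ-basis l))

  ε : Fin 9 → Bool
  ε k = proj₁ (coordinates k)

  p-coordinates : ∀ k → v (p k) ≡ Φ (ε k ∷ u k)
  p-coordinates k = proj₂ (coordinates k)

  ε-basis : ∀ l → ε (basis l) ≡ false
  ε-basis l = cong head (Φ-injective (ε (basis l) ∷ u (basis l)) (false ∷ u (basis l))
    (trans (sym (p-coordinates (basis l))) (sym (Φ-basis l))))

  opaque
    twin : Fin 9 → Bool
    twin k = ⌊ any? (λ i → v i ≟ᵛ Φ (not (ε k) ∷ u k)) ⌋

    twin-sound : ∀ k → twin k ≡ true → ∃ λ i → v i ≡ Φ (not (ε k) ∷ u k)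
    twin-sound k h with any? (λ i → v i ≟ᵛ Φ (not (ε k) ∷ u k))
    ... | yes found = found

    twin-complete : ∀ k i → v i ≡ Φ (not (ε k) ∷ u k) → twin k ≡ true
    twin-complete k i vi≡ with any? (λ i → v i ≟ᵛ Φ (not (ε k) ∷ u k))
    ... | yes _ = refl
    ... | no ∄i = ⊥-elim (∄i (i , vi≡))

  εs : Vec Bool 5
  εs = tabulate (ε ∘ nonbasis)

  twins : Vec Bool 9
  twins = tabulate twin

  εOf-εs : ∀ k → εOf εs k ≡ ε k
  εOf-εs = nonbasis-or-basis (λ k → εOf εs k ≡ ε k)
    (λ k → trans (cong [ lookup εs , (λ _ → false) ]′ (splitAt-↑ˡ 5 k 4)) (lookup∘tabulate (ε ∘ nonbasis) k))
    (λ l → trans (cong [ lookup εs , (λ _ → false) ]′ (splitAt-↑ʳ 5 4 l)) (sym (ε-basis l)))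

  occupied-column : ∀ t k → occupied εs twins (t ∷ u k) ≡ (⌊ t ≟ᵇ ε k ⌋ ∨ twin k)
  occupied-column t k = trans (occupied-u εs twins t k)
    (cong₂ (λ a b → ⌊ t ≟ᵇ a ⌋ ∨ b) (εOf-εs k) (lookup∘tabulate twin k))

  column-sound : ∀ t k → (⌊ t ≟ᵇ ε k ⌋ ∨ twin k) ≡ true → ∃ λ i → v i ≡ Φ (t ∷ u k)
  column-sound t k h with t ≟ᵇ ε k
  ... | yes refl = p k , p-coordinates k
  ... | no t≢εk with twin-sound k h
  ...   | i , vi≡ = i , trans vi≡ (cong (λ s → Φ (s ∷ u k)) (sym (¬-not t≢εk)))

  column-complete : ∀ t k i → v i ≡ Φ (t ∷ u k) → (⌊ t ≟ᵇ ε k ⌋ ∨ twin k) ≡ true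
  column-complete t k i vi≡ with t ≟ᵇ ε k
  ... | yes _ = refl
  ... | no t≢εk = twin-complete k i (trans vi≡ (cong (λ s → Φ (s ∷ u k)) (¬-not t≢εk)))

  occupied-sound : ∀ c → occupied εs twins c ≡ true → ∃ λ i → v i ≡ Φ c
  occupied-sound (t ∷ x) h with x ==ᵛ 0v in x≡0 | indexOf u x in index
  ... | true  | _       = e , trans (sym Φ-e) (cong₂ (λ s y → Φ (s ∷ y)) (sym h) (sym (==ᵛ-sound x 0v x≡0)))
  ... | false | nothing = ⊥-elim (true≢false (sym h))
  ... | false | just k  = subst (λ y → ∃ λ i → v i ≡ Φ (t ∷ y)) (indexOf-sound u x k index)
    (column-sound t k (trans (sym (cong₂ (λ a b → ⌊ t ≟ᵇ a ⌋ ∨ b) (εOf-εs k) (lookup∘tabulate twin k))) h))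

  representative : ∀ {i} → i ≢ e → ∃ λ j → R j ≡ true × (v j ≡ v i ⊎ v j ≡ v i ⊕ v e)
  representative {i} i≢e with proj₂ (proj₂ (proj₂ reps)) i (contraction-nonloop simple i≢e)
  ... | inj₁ Ri = i , Ri , inj₁ refl
  ... | inj₂ (j , Rj , i∥j) = j , Rj , contraction-parallel simple i≢e i∥j

  shift-by-e : ∀ {i j} t x → (v j ≡ v i ⊎ v j ≡ v i ⊕ v e) → v i ≡ Φ (t ∷ x) → ∃ λ s → v j ≡ Φ (s ∷ x)
  shift-by-e t x (inj₁ vj≡vi) vi≡Φ = t , trans vj≡vi vi≡Φ
  shift-by-e {i} {j} t x (inj₂ vj≡vi+ve) vi≡Φ = not t , (begin
    v j                            ≡⟨ vj≡vi+ve ⟩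
    v i ⊕ v e                      ≡⟨ cong₂ _⊕_ vi≡Φ (sym Φ-e) ⟩
    Φ (t ∷ x) ⊕ Φ (true ∷ 0v)      ≡⟨ sym (homo Φ-linear (t ∷ x) (true ∷ 0v)) ⟩
    Φ ((t xor true) ∷ (x ⊕ 0v))    ≡⟨ cong₂ (λ s y → Φ (s ∷ y)) (xor-comm t true) (⊕-identityʳ x) ⟩
    Φ (not t ∷ x)                  ∎)
    where open ≡-Reasoning

  -- a representative lying in the span of e, p₅, …, p₈ lies in the closure of the basis p₅, …, p₈ of N|F
  representative-in-F : ∀ {j} c → R j ≡ true → v j ≡ Φ c → F j ≡ true
  representative-in-F {j} c Rj vj≡Φc with F j in Fj
  ... | true  = refl
  ... | false = ⊥-elim (true≢false (trans (sym (proj₂ F-flat j Rj (inj₂ (B , B⊆F , B-independent , B∪j-dependent)))) Fj))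
    where
    B : Sub m
    B = pullback (onBasis (replicate 4 true))
    B⊆F : B ⊆ F
    B⊆F i h = ∧-conicalˡ _ _ h
    B-independent : Ind (Restrict (Contract (VecMatroid v) e) R) B
    B-independent = proj₂ (proj₁ (pullback-independence _) basis-independent)
    basis∈B : ∀ l → B (p (basis l)) ≡ true
    basis∈B l rewrite p∈F (basis l) | f∘p (basis l) =
      trans (image-at basis (lookup (replicate 4 true)) basis-injective l) (lookup-replicate l true)
    Z : Sub m
    Z = image (P ∘ ι) (lookup c)
    Z⊆ : Z ⊆ ((B ∪ ｛ j ｝) ∪ ｛ e ｝)
    Z⊆ k Zk with image-true (P ∘ ι) (lookup c) k Zk
    ... | zero  , refl , _ rewrite ｛｝-self e = ∨-zeroʳ _
    ... | suc l , refl , _ rewrite basis∈B l = refl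
    j∈ : ((B ∪ ｛ j ｝) ∪ ｛ e ｝) j ≡ true
    j∈ rewrite ｛｝-self j | ∨-zeroʳ (B j) = refl
    j∉Z : Z j ≡ false
    j∉Z = image-outside (P ∘ ι) (lookup c) j λ
      { zero    e≡j  → ∈E/e⇒≢ (proj₁ reps j Rj) (sym e≡j)
      ; (suc l) pl≡j → true≢false (trans (sym (p∈F (basis l))) (trans (cong F pl≡j) Fj)) }
    B∪j-dependent : ¬ Ind (Restrict (Contract (VecMatroid v) e) R) (B ∪ ｛ j ｝)
    B∪j-dependent (_ , _ , li) =
      in-span⇒dependent v _ Z j Z⊆ j∈ j∉Z (trans vj≡Φc (sym (sumOver-image v (P ∘ ι) (lookup c)))) li

  column-of : ∀ {i} t x → i ≢ e → v i ≡ Φ (t ∷ x) → ∃ λ k → x ≡ u k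
  column-of t x i≢e vi≡Φ with representative i≢e
  ... | j , Rj , vj≡ with shift-by-e t x vj≡ vi≡Φ
  ...   | s , vj≡Φ = f j , cong tail (Φ-injective (s ∷ x) (ε (f j) ∷ u (f j)) (begin
    Φ (s ∷ x)               ≡⟨ sym vj≡Φ ⟩
    v j                     ≡⟨ cong v (sym (p∘f j (representative-in-F (s ∷ x) Rj vj≡Φ))) ⟩
    v (p (f j))             ≡⟨ p-coordinates (f j) ⟩
    Φ (ε (f j) ∷ u (f j))   ∎))
    where open ≡-Reasoning

  occupied-e : ∀ c → v e ≡ Φ c → occupied εs twins c ≡ true
  occupied-e c ve≡Φ = subst (λ c → occupied εs twins c ≡ true) (Φ-injective (true ∷ 0v) c (trans Φ-e ve≡Φ)) refl

  occupied-other : ∀ i t x → i ≢ e → v i ≡ Φ (t ∷ x) → occupied εs twins (t ∷ x) ≡ true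
  occupied-other i t x i≢e vi≡Φ =
    let k , x≡uk = column-of t x i≢e vi≡Φ in
    subst (λ y → occupied εs twins (t ∷ y) ≡ true) (sym x≡uk)
      (trans (occupied-column t k) (column-complete t k i (subst (λ y → v i ≡ Φ (t ∷ y)) x≡uk vi≡Φ)))

  occupied-complete : ∀ i c → v i ≡ Φ c → occupied εs twins c ≡ true
  occupied-complete i (t ∷ x) vi≡Φ with i ≟ e
  ... | yes refl = occupied-e (t ∷ x) vi≡Φ
  ... | no i≢e   = occupied-other i t x i≢e vi≡Φ

  template-restriction : ∀ τ → valid τ ≡ true → fits εs twins τ ≡ true →
                         HasInducedRestr (VecMatroid v) (VecMatroid (columns (target τ)))
  template-restriction τ τ-valid τ-fits = SubspaceRestriction.induced-restriction
    v (simple⇒injective simple) (columns w) (columns-injective w) (first-column w)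
    Ψ Ψ-linear Ψ-kernel q q-realises closed
    where
    w : Target
    w = target τ
    Ψ : GF2^ (rank w) → GF2^ r
    Ψ = Φ ∘ embed τ
    Ψ-linear : Linear Ψ
    Ψ-linear = ∘-linear Φ-linear (combination-linear (lookup (embedding τ)))
    Ψ-kernel : ∀ y → Ψ y ≡ 0v → y ≡ 0v
    Ψ-kernel y Ψy≡0 = embed-kernel τ τ-valid y (Φ-kernel (embed τ y) Ψy≡0)
    column-occupied : ∀ j → occupied εs twins (embed τ (columns w j)) ≡ true
    column-occupied j = ∈ᵇ-all (occupied εs twins) (embed τ (columns w j)) (inside τ) (columns-inside τ τ-valid j)
      (∧-conicalˡ (all (occupied εs twins) (inside τ)) _ τ-fits)
    q : Fin (size w) → Fin m
    q j = proj₁ (occupied-sound (embed τ (columns w j)) (column-occupied j))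
    q-realises : ∀ j → v (q j) ≡ Ψ (columns w j)
    q-realises j = proj₂ (occupied-sound (embed τ (columns w j)) (column-occupied j))
    closed : ∀ i y → v i ≡ Ψ y → ∃ λ j → v i ≡ Ψ (columns w j)
    closed i y vi≡Ψy with isColumnᵇ w y in column
    ... | true with anyFinᵇ-sound (size w) (λ j → columns w j ==ᵛ y) column
    ...   | j , wj==y = j , trans vi≡Ψy (cong Ψ (sym (==ᵛ-sound (columns w j) y wj==y)))
    closed i y vi≡Ψy | false = ⊥-elim (true≢false (trans (sym (occupied-complete i (embed τ y) vi≡Ψy)) unoccupied))
      where
      unoccupied : occupied εs twins (embed τ y) ≡ false
      unoccupied = not-injective (∈ᵇ-all (not ∘ occupied εs twins) (embed τ y) (outside τ) (others-outside τ τ-valid y column)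
        (∧-conicalʳ (all (occupied εs twins) (inside τ)) _ τ-fits))

as-disjunction : ∀ {m} {M : Matroid m} w → HasInducedRestr M (VecMatroid (columns w)) →
                 HasInducedRestr M MC4 ⊎ HasInducedRestr M MK4 ⊎ HasInducedRestr M MK33*
as-disjunction C₄   = inj₁
as-disjunction K₄   = inj₂ ∘ inj₁
as-disjunction K₃₃* = inj₂ ∘ inj₂

lemma3p3 : ∀ {m r} (v : Fin m → GF2^ r) → Simple (VecMatroid v) → (e : Fin m) →
    Σ (Sub m) (λ R → SiReps (Contract (VecMatroid v) e) R
                   × HasInducedRestr (Restrict (Contract (VecMatroid v) e) R) MK33*) →
    HasInducedRestr (VecMatroid v) MC4
      ⊎ HasInducedRestr (VecMatroid v) MK4
      ⊎ HasInducedRestr (VecMatroid v) MK33*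
lemma3p3 v simple e (R , reps , F , F-flat , iso) =
  let τ , τ-valid , τ-fits = template-exists εs twins
  in as-disjunction (target τ) (template-restriction τ τ-valid τ-fits)
  where open Coordinates v simple e R reps F F-flat iso
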